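{- Let $P$ and $Q$ be finite connected posets on disjoint finite sets $X_1$ and $X_2$. Then $$\delta(P\searrow Q)=P\otimes Q+(P\otimes\mathbf 1+\mathbf 1\otimes P)\searrow\delta(Q),$$ where $\mathbf 1$ denotes the empty poset.
   Context: $\mathbb U_X$ is the vector space spanned by connected partial orders on the finite set $X$; $\min(P)$ is the set of minimal elements. For $P$ on $X_1$, $Q$ on $X_2$ disjoint and $v\in X_2$, $P\searrow_v Q$ is the poset on $X_1\sqcup X_2$ whose Hasse diagram is obtained from those of $P$ and $Q$ by adding an edge from $v$ up to every minimal element of $P$ (order generated by $\le_P,\le_Q$ and $v<m$ for $m\in\min P$); $P\searrow Q=\sum_{v\in X_2}P\searrow_v Q$, extended bilinearly. On tensors, $(P\otimes\mathbf 1)\searrow(A\otimes B)=(P\searrow A)\otimes B$ and $(\mathbf 1\otimes P)\searrow(A\otimes B)=A\otimes(P\searrow B)$, extended linearly. The coproduct is $\delta(P)=\frac{1}{|\min(P)|}\sum_{I\circledcirc P}P_{|I}\otimes P\setminus I$, where $P_{|I}$ is the induced subposet, $P\setminus I$ the subposet induced on the complement, $I_-=\{x\notin I:\exists y\in I,\ x\le_P y\}$, and $I\circledcirc P$ means $I_-$ is a singleton $\{w\}$ with $w\in\min(P)$ and $I$ is a connected component (in the comparability graph) of $\{x: w<_P x\}$. -}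

module Defs where

open import Data.Nat using (ℕ; zero; suc)
open import Data.Fin using (Fin; zero; suc; _≟_)
open import Data.Bool using (Bool; true; false; _∧_; _∨_; not; _xor_; T; if_then_else_)
open import Data.List using (List; []; _∷_; _++_; map; concatMap; foldr; allFin)
open import Data.Product using (_×_; _,_; ∃)
open import Data.Sum using (_⊎_)
open import Data.Integer using (+_)
open import Data.Rational using (ℚ; 0ℚ; 1ℚ; _+_; _*_; _/_)
open import Relation.Nullary.Decidable using (⌊_⌋)
open import Relation.Binary.PropositionalEquality using (_≡_)

allF : ∀ {n} → (Fin n → Bool) → Bool
allF {zero}  f = true
allF {suc n} f = f zero ∧ allF (λ i → f (suc i))

anyF : ∀ {n} → (Fin n → Bool) → Bool
anyF {zero}  f = false
anyF {suc n} f = f zero ∨ anyF (λ i → f (suc i))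

countF : ∀ {n} → (Fin n → Bool) → ℕ
countF {zero}  f = zero
countF {suc n} f = (if f zero then suc else (λ k → k)) (countF (λ i → f (suc i)))

_⇒ᵇ_ : Bool → Bool → Bool
a ⇒ᵇ b = not a ∨ b

_==_ : ∀ {n} → Fin n → Fin n → Bool
x == y = ⌊ x ≟ y ⌋

iter : {A : Set} → ℕ → (A → A) → A → A
iter zero    f a = a
iter (suc k) f a = f (iter k f a)

-- A (labelled) poset on a subset X ⊆ Fin N is a relation R with
-- R x y = true iff x,y ∈ X and x ≤ y.  Its ground set is {x | R x x}.
-- The empty poset 𝟏 is the constantly-false relation.

Sub : ℕ → Set
Sub N = Fin N → Bool

Rel : ℕ → Set
Rel N = Fin N → Fin N → Bool

record IsPoset {N : ℕ} (R : Rel N) : Set where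
  field
    onGround : ∀ x y → T (R x y) → T (R x x) × T (R y y)
    antisym  : ∀ x y → T (R x y) → T (R y x) → x ≡ y
    trans    : ∀ x y z → T (R x y) → T (R y z) → T (R x z)

data Chain {N : ℕ} (R : Rel N) : Fin N → Fin N → Set where
  here : ∀ {x} → Chain R x x
  step : ∀ {x y z} → (T (R x y) ⊎ T (R y x)) → Chain R y z → Chain R x z

IsConnected : ∀ {N} → Rel N → Set
IsConnected {N} R =
  ∃ (λ x → T (R x x)) × (∀ x y → T (R x x) → T (R y y) → Chain R x y)

Disjoint : ∀ {N} → Rel N → Rel N → Set
Disjoint P Q = ∀ x → T (P x x) → T (Q x x) → Data.Empty.⊥
  where import Data.Empty

-- Transitive closure (boolean matrices; N squaring steps suffice on Fin N)

closure : ∀ {N} → Rel N → Rel N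
closure {N} R = iter N (λ S x y → S x y ∨ anyF (λ z → S x z ∧ S z y)) R

restrict : ∀ {N} → Rel N → Sub N → Rel N
restrict R S x y = R x y ∧ S x ∧ S y

compl : ∀ {N} → Sub N → Sub N
compl S x = not (S x)

isMin : ∀ {N} → Rel N → Fin N → Bool
isMin R y = R y y ∧ allF (λ z → R z y ⇒ᵇ (z == y))

numMin : ∀ {N} → Rel N → ℕ
numMin R = countF (isMin R)

connectedB : ∀ {N} → Rel N → Bool
connectedB R =
  anyF (λ x → R x x) ∧
  allF (λ x → allF (λ y → (R x x ∧ R y y) ⇒ᵇ closure (λ a b → R a b ∨ R b a) x y))

comparableB : ∀ {N} → Rel N → Fin N → Fin N → Bool
comparableB R x y = R x y ∨ R y x

isComponent : ∀ {N} → Rel N → Sub N → Sub N → Bool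
isComponent P U I =
  allF (λ x → I x ⇒ᵇ U x) ∧
  connectedB (restrict P I) ∧
  allF (λ x → allF (λ y → (I x ∧ U y ∧ not (I y)) ⇒ᵇ not (comparableB P x y)))

Iminus : ∀ {N} → Rel N → Sub N → Sub N
Iminus P I x = not (I x) ∧ anyF (λ y → I y ∧ P x y)

circ : ∀ {N} → Rel N → Sub N → Bool
circ P I =
  anyF (λ w → isMin P w ∧
               allF (λ x → not (Iminus P I x xor (x == w))) ∧
               isComponent P (λ x → P w x ∧ not (w == x)) I)

allSubs : ∀ N → List (Sub N)
allSubs zero    = (λ ()) ∷ []
allSubs (suc n) = concatMap (λ s → cons false s ∷ cons true s ∷ []) (allSubs n)
  where
  cons : Bool → Sub n → Sub (suc n)
  cons b s zero    = b
  cons b s (suc i) = s i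

-- Formal ℚ-linear combinations of posets, and of pairs (tensors)

Lin : ℕ → Set
Lin N = List (ℚ × Rel N)

Tensor : ℕ → Set
Tensor N = List (ℚ × Rel N × Rel N)

invℕ : ℕ → ℚ
invℕ zero    = 0ℚ
invℕ (suc k) = (+ 1) / suc k

δ : ∀ {N} → Rel N → Tensor N
δ {N} P = concatMap
  (λ I → if circ P I
         then (invℕ (numMin P) , restrict P I , restrict P (compl I)) ∷ []
         else [])
  (allSubs N)

δlin : ∀ {N} → Lin N → Tensor N
δlin = concatMap (λ { (c , R) → map (λ { (d , A , B) → (c * d , A , B) }) (δ R) })

-- P ↘_v Q : order generated by ≤P, ≤Q and v < m for m ∈ min P
graftAt : ∀ {N} → Rel N → Fin N → Rel N → Rel N
graftAt P v Q = closure (λ x y → P x y ∨ Q x y ∨ ((x == v) ∧ isMin P y))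

graft : ∀ {N} → Rel N → Rel N → Lin N
graft {N} P Q = concatMap
  (λ v → if Q v v then (1ℚ , graftAt P v Q) ∷ [] else [])
  (allFin N)

-- (P ⊗ 𝟏) ↘ T   and   (𝟏 ⊗ P) ↘ T
graftL : ∀ {N} → Rel N → Tensor N → Tensor N
graftL P = concatMap (λ { (c , A , B) → map (λ { (d , A') → (c * d , A' , B) }) (graft P A) })

graftR : ∀ {N} → Rel N → Tensor N → Tensor N
graftR P = concatMap (λ { (c , A , B) → map (λ { (d , B') → (c * d , A , B') }) (graft P B) })

eqRel : ∀ {N} → Rel N → Rel N → Bool
eqRel R S = allF (λ x → allF (λ y → not (R x y xor S x y)))

coef : ∀ {N} → Tensor N → Rel N → Rel N → ℚ
coef T A B = foldr (λ { (c , A' , B') acc → (if eqRel A A' ∧ eqRel B B' then c else 0ℚ) + acc }) 0ℚ T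

_≈ᵀ_ : ∀ {N} → Tensor N → Tensor N → Set
_≈ᵀ_ {N} S T = ∀ (A B : Rel N) → coef S A B ≡ coef T A B

{-# OPTIONS --safe #-}
-- Compare the coefficients of a basis tensor A ⊗ B on both sides.  The order of P ↘ᵥ Q is
-- explicit (x ≤ y iff x ≤_P y, or x ≤_Q y, or x ≤_Q v and y ∈ P), so its minimal elements
-- are those of Q.  Its cuts I ⊚ (P ↘ᵥ Q) come in two kinds: the ground set of P, a cut
-- exactly when v is minimal in Q, splitting P ↘ᵥ Q into P ⊗ Q; and, for each cut J ⊚ Q, the
-- set J ∪ P (if v ∈ J) or J (if v ∉ J), splitting P ↘ᵥ Q into (P ↘ᵥ Q|J) ⊗ Q∖J or
-- Q|J ⊗ (P ↘ᵥ Q∖J) respectively.  Summing over v, the first kind contributes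
-- #min(Q) · (1 / #min(Q)) · P ⊗ Q = P ⊗ Q, and the second kind is (P ⊗ 𝟏 + 𝟏 ⊗ P) ↘ δ(Q).
module Submission where

open import Defs
open import Data.Nat using (ℕ; zero; suc)
open import Data.Fin using (Fin; zero; suc) renaming (_≟_ to _≟ᶠ_)
open import Data.Bool using (Bool; true; false; _∧_; _∨_; not; _xor_; T; if_then_else_)
open import Data.List using (List; []; _∷_; _++_; map; concatMap; allFin; tabulate)
open import Data.Product using (_×_; _,_; ∃; proj₁; proj₂)
open import Data.Sum using (_⊎_; inj₁; inj₂; [_,_]′) renaming (map to ⊎-map; map₂ to ⊎-map₂)
open import Data.Empty using (⊥; ⊥-elim)
open import Data.Unit using (tt)
open import Relation.Nullary using (¬_; yes; no)
open import Relation.Binary.PropositionalEquality hiding (J; [_])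

_≐_ : ∀ {N} → Rel N → Rel N → Set
R ≐ S = ∀ x y → R x y ≡ S x y

ground : ∀ {N} → Rel N → Sub N
ground R x = R x x

∧-intro : ∀ {a b} → T a → T b → T (a ∧ b)
∧-intro {true} {true} _ _ = tt

∧-fst : ∀ {a b} → T (a ∧ b) → T a
∧-fst {true} _ = tt

∧-snd : ∀ {a b} → T (a ∧ b) → T b
∧-snd {true} {true} _ = tt

∨-inl : ∀ {a b} → T a → T (a ∨ b)
∨-inl {true} _ = tt

∨-inr : ∀ {a b} → T b → T (a ∨ b)
∨-inr {true} _ = tt
∨-inr {false} p = p

∨-cases : ∀ {a b} → T (a ∨ b) → T a ⊎ T b
∨-cases {true} _ = inj₁ tt
∨-cases {false} p = inj₂ p

not-intro : ∀ {a} → ¬ T a → T (not a)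
not-intro {false} _ = tt
not-intro {true} f = f tt

not-elim : ∀ {a} → T (not a) → ¬ T a
not-elim {false} _ ()
not-elim {true} ()

⇒ᵇ-intro : ∀ {a b} → (T a → T b) → T (a ⇒ᵇ b)
⇒ᵇ-intro {false} _ = tt
⇒ᵇ-intro {true} f = f tt

⇒ᵇ-elim : ∀ {a b} → T (a ⇒ᵇ b) → T a → T b
⇒ᵇ-elim {true} {true} _ _ = tt

T-cases : ∀ a → T a ⊎ ¬ T a
T-cases true = inj₁ tt
T-cases false = inj₂ (λ ())

T-ext : ∀ {a b} → (T a → T b) → (T b → T a) → a ≡ b
T-ext {false} {false} _ _ = refl
T-ext {false} {true} _ g = ⊥-elim (g tt)
T-ext {true} {false} f _ = ⊥-elim (f tt)
T-ext {true} {true} _ _ = refl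

xnor⇒≡ : ∀ {a b} → T (not (a xor b)) → a ≡ b
xnor⇒≡ {false} {false} _ = refl
xnor⇒≡ {true} {true} _ = refl

≡⇒xnor : ∀ {a b} → a ≡ b → T (not (a xor b))
≡⇒xnor {false} refl = tt
≡⇒xnor {true} refl = tt

≡⇒== : ∀ {n} {x y : Fin n} → x ≡ y → T (x == y)
≡⇒== {x = x} {y} x≡y with x ≟ᶠ y
... | yes _ = tt
... | no x≢y = x≢y x≡y

==⇒≡ : ∀ {n} {x y : Fin n} → T (x == y) → x ≡ y
==⇒≡ {x = x} {y} t with x ≟ᶠ y
... | yes x≡y = x≡y
... | no _ = ⊥-elim t

≢⇒not== : ∀ {n} {x y : Fin n} → ¬ x ≡ y → T (not (x == y))
≢⇒not== x≢y = not-intro (λ t → x≢y (==⇒≡ t))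

allF-intro : ∀ {n} {f : Fin n → Bool} → (∀ i → T (f i)) → T (allF f)
allF-intro {zero} h = tt
allF-intro {suc n} h = ∧-intro (h zero) (allF-intro (λ i → h (suc i)))

allF-elim : ∀ {n} {f : Fin n → Bool} → T (allF f) → ∀ i → T (f i)
allF-elim {suc n} t zero = ∧-fst t
allF-elim {suc n} {f} t (suc i) = allF-elim {n} {λ j → f (suc j)} (∧-snd {f zero} t) i

anyF-intro : ∀ {n} {f : Fin n → Bool} i → T (f i) → T (anyF f)
anyF-intro {suc n} zero t = ∨-inl t
anyF-intro {suc n} {f} (suc i) t = ∨-inr {f zero} (anyF-intro {n} {λ j → f (suc j)} i t)

anyF-elim : ∀ {n} {f : Fin n → Bool} → T (anyF f) → ∃ λ i → T (f i)
anyF-elim {suc n} {f} t with ∨-cases {f zero} t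
... | inj₁ t₀ = zero , t₀
... | inj₂ t′ with anyF-elim {n} {λ j → f (suc j)} t′
... | i , tᵢ = suc i , tᵢ

anyF-cases : ∀ {n} (f : Fin n → Bool) → (∃ λ i → T (f i)) ⊎ (∀ i → ¬ T (f i))
anyF-cases f with T-cases (anyF f)
... | inj₁ t = inj₁ (anyF-elim t)
... | inj₂ ¬t = inj₂ (λ i fᵢ → ¬t (anyF-intro i fᵢ))

allF-counterexample : ∀ {n} {f : Fin n → Bool} → ¬ T (allF f) → ∃ λ i → ¬ T (f i)
allF-counterexample {zero} ¬all = ⊥-elim (¬all tt)
allF-counterexample {suc n} {f} ¬all with T-cases (f zero)
... | inj₂ ¬f₀ = zero , ¬f₀
... | inj₁ f₀ with allF-counterexample {n} {λ i → f (suc i)} (λ all → ¬all (∧-intro f₀ all))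
... | i , ¬fᵢ = suc i , ¬fᵢ

⇒ᵇ-counterexample : ∀ {a b} → ¬ T (a ⇒ᵇ b) → T a × ¬ T b
⇒ᵇ-counterexample {false} ¬a⇒b = ⊥-elim (¬a⇒b tt)
⇒ᵇ-counterexample {true} {b} ¬a⇒b = tt , ¬a⇒b

allF-cong : ∀ {n} {f g : Fin n → Bool} → f ≗ g → allF f ≡ allF g
allF-cong {zero} h = refl
allF-cong {suc n} h = cong₂ _∧_ (h zero) (allF-cong (λ i → h (suc i)))

anyF-cong : ∀ {n} {f g : Fin n → Bool} → f ≗ g → anyF f ≡ anyF g
anyF-cong {zero} h = refl
anyF-cong {suc n} h = cong₂ _∨_ (h zero) (anyF-cong (λ i → h (suc i)))

countF-cong : ∀ {n} {f g : Fin n → Bool} → f ≗ g → countF f ≡ countF g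
countF-cong {zero} h = refl
countF-cong {suc n} h = cong₂ (λ b k → (if b then suc else (λ k → k)) k) (h zero) (countF-cong (λ i → h (suc i)))

module TransitiveClosure where
  open import Data.Nat using (_+_; _∸_; _≤_; _<_; _≤?_; z≤n; s≤s)
  open import Data.Nat.Properties using (+-comm; +-monoˡ-<; m+[n∸m]≡n; ≤-pred; ≰⇒>; <⇒≤)
  open import Data.Nat.Induction using (<-wellFounded)
  open import Data.Fin using (toℕ)
  open import Data.Fin.Properties using (pigeonhole; toℕ<n)
  open import Induction.WellFounded using (Acc; acc)

  data Walk {N : ℕ} (R : Rel N) : Fin N → Fin N → ℕ → Set where
    nil  : ∀ {x} → Walk R x x 0
    cons : ∀ {x y z n} → T (R x y) → Walk R y z n → Walk R x z (suc n)

  Plus : ∀ {N} → Rel N → Fin N → Fin N → Set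
  Plus R x y = ∃ λ n → Walk R x y (suc n)

  module _ {N : ℕ} {R : Rel N} where
    walk-++ : ∀ {x y z m n} → Walk R x y m → Walk R y z n → Walk R x z (m + n)
    walk-++ nil q = q
    walk-++ (cons e p) q = cons e (walk-++ p q)

    Plus-edge : ∀ {x y} → T (R x y) → Plus R x y
    Plus-edge e = 0 , cons e nil

    Plus-trans : ∀ {x y z} → Plus R x y → Plus R y z → Plus R x z
    Plus-trans (m , p) (n , q) = m + suc n , walk-++ p q

    Star : Fin N → Fin N → Set
    Star x y = x ≡ y ⊎ Plus R x y

    Star-trans : ∀ {x y z} → Star x y → Star y z → Star x z
    Star-trans (inj₁ refl) s = s
    Star-trans (inj₂ p) (inj₁ refl) = inj₂ p
    Star-trans (inj₂ p) (inj₂ q) = inj₂ (Plus-trans p q)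

    walk-reverse : (∀ a b → T (R a b) → T (R b a)) → ∀ {x y n} → Walk R x y n → Walk R y x n
    walk-reverse sym-R nil = nil
    walk-reverse sym-R (cons e p) =
      subst (Walk R _ _) (+-comm _ 1) (walk-++ (walk-reverse sym-R p) (cons (sym-R _ _ e) nil))

    Plus-sym : (∀ a b → T (R a b) → T (R b a)) → ∀ {x y} → Plus R x y → Plus R y x
    Plus-sym sym-R (n , p) = n , walk-reverse sym-R p

    walk-vertex : ∀ {x y n} → Walk R x y n → Fin (suc n) → Fin N
    walk-vertex {x} p zero = x
    walk-vertex (cons e p) (suc i) = walk-vertex p i

    walk-take : ∀ {x y n} (p : Walk R x y n) (i : Fin (suc n)) → Walk R x (walk-vertex p i) (toℕ i)
    walk-take p zero = nil
    walk-take (cons e p) (suc i) = cons e (walk-take p i)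

    walk-drop : ∀ {x y n} (p : Walk R x y n) (i : Fin (suc n)) → Walk R (walk-vertex p i) y (n ∸ toℕ i)
    walk-drop p zero = p
    walk-drop (cons e p) (suc i) = walk-drop p i

    -- A walk with more than N steps visits some vertex twice; cut out the loop.
    walk-shorten : ∀ {x y n} → N < suc n → Walk R x y (suc n) → ∃ λ m → m < n × Walk R x y (suc m)
    walk-shorten {y = y} {n} N<1+n p with pigeonhole N<1+n (λ k → walk-vertex p (suc k))
    ... | i , j , i<j , vᵢ≡vⱼ =
      toℕ i + (n ∸ toℕ j) , shorter ,
      walk-++ (walk-take p (suc i)) (subst (λ u → Walk R u y (n ∸ toℕ j)) (sym vᵢ≡vⱼ) (walk-drop p (suc j)))
      where
      shorter : toℕ i + (n ∸ toℕ j) < n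
      shorter = subst (toℕ i + (n ∸ toℕ j) <_) (m+[n∸m]≡n (≤-pred (toℕ<n j))) (+-monoˡ-< (n ∸ toℕ j) i<j)

    walk-shortest : ∀ {x y n} → Acc _<_ n → Walk R x y (suc n) → ∃ λ m → m < N × Walk R x y (suc m)
    walk-shortest {n = n} (acc rs) p with suc n ≤? N
    ... | yes 1+n≤N = n , 1+n≤N , p
    ... | no 1+n≰N with walk-shorten (≰⇒> 1+n≰N) p
    ... | m , m<n , q = walk-shortest (rs m<n) q

  module _ {N : ℕ} {R R′ : Rel N} where
    walk-image : (f : Fin N → Fin N) → (∀ a b → T (R a b) → f a ≡ f b ⊎ T (R′ (f a) (f b))) →
                 ∀ {x y n} → Walk R x y n → Star {R = R′} (f x) (f y)
    walk-image f h nil = inj₁ refl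
    walk-image f h (cons e p) with h _ _ e
    ... | inj₁ eq = Star-trans (inj₁ eq) (walk-image f h p)
    ... | inj₂ e′ = Star-trans (inj₂ (Plus-edge e′)) (walk-image f h p)

    Plus-image : (f : Fin N → Fin N) → (∀ a b → T (R a b) → f a ≡ f b ⊎ T (R′ (f a) (f b))) →
                 ∀ {x y} → Plus R x y → Star {R = R′} (f x) (f y)
    Plus-image f h (n , p) = walk-image f h p

    Plus-mono : (∀ a b → T (R a b) → T (R′ a b)) → ∀ {x y} → Plus R x y → Plus R′ x y
    Plus-mono h (n , p) = n , walk-map p
      where
      walk-map : ∀ {x y n} → Walk R x y n → Walk R′ x y n
      walk-map nil = nil
      walk-map (cons e p) = cons (h _ _ e) (walk-map p)

  squareStep : ∀ {N} → Rel N → Rel N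
  squareStep S x y = S x y ∨ anyF (λ z → S x z ∧ S z y)

  module _ {N : ℕ} (R : Rel N) where
    iter-sound : ∀ k {x y} → T (iter k squareStep R x y) → Plus R x y
    iter-sound zero t = Plus-edge t
    iter-sound (suc k) {x} {y} t with ∨-cases {iter k squareStep R x y} t
    ... | inj₁ t′ = iter-sound k t′
    ... | inj₂ t′ with anyF-elim t′
    ... | z , c = Plus-trans (iter-sound k (∧-fst c)) (iter-sound k (∧-snd {iter k squareStep R x z} c))

    iter-inflationary : ∀ k {x y} → T (R x y) → T (iter k squareStep R x y)
    iter-inflationary zero e = e
    iter-inflationary (suc k) e = ∨-inl (iter-inflationary k e)

    walk⇒iter : ∀ k {x y n} → n ≤ k → Walk R x y (suc n) → T (iter k squareStep R x y)
    walk⇒iter k z≤n (cons e nil) = iter-inflationary k e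
    walk⇒iter (suc k) {x} {z} (s≤s n≤k) (cons {y = y} e p) =
      ∨-inr {iter k squareStep R x z}
            (anyF-intro y (∧-intro (iter-inflationary k e) (walk⇒iter k n≤k p)))

    closure-sound : ∀ {x y} → T (closure R x y) → Plus R x y
    closure-sound = iter-sound N

    closure-complete : ∀ {x y} → Plus R x y → T (closure R x y)
    closure-complete (n , p) with walk-shortest (<-wellFounded n) p
    ... | m , m<N , q = walk⇒iter N (<⇒≤ m<N) q

    closure-cong : ∀ {R′} → R ≐ R′ → closure R ≐ closure R′
    closure-cong {R′} R≐R′ = go N
      where
      go : ∀ k → iter k squareStep R ≐ iter k squareStep R′
      go zero = R≐R′
      go (suc k) x y = cong₂ _∨_ (go k x y) (anyF-cong (λ z → cong₂ _∧_ (go k x z) (go k z y)))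

open TransitiveClosure

module FiniteOrder where
  open import Data.Nat using (_≤_; _<_; z≤n; s≤s)
  open import Data.Nat.Properties using (m≤n⇒m≤1+n)
  open import Data.Nat.Induction using (<-wellFounded)
  open import Induction.WellFounded using (Acc; acc)

  countF-mono : ∀ {n} {f g : Fin n → Bool} → (∀ i → T (f i) → T (g i)) → countF f ≤ countF g
  countF-mono {zero} f⊆g = z≤n
  countF-mono {suc n} {f} {g} f⊆g with f zero | g zero | f⊆g zero
  ... | false | false | _ = countF-mono {n} (λ i → f⊆g (suc i))
  ... | false | true  | _ = m≤n⇒m≤1+n (countF-mono {n} (λ i → f⊆g (suc i)))
  ... | true  | false | k = ⊥-elim (k tt)
  ... | true  | true  | _ = s≤s (countF-mono {n} (λ i → f⊆g (suc i)))

  countF-mono-< : ∀ {n} {f g : Fin n → Bool} → (∀ i → T (f i) → T (g i)) →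
                  ∀ j → T (g j) → ¬ T (f j) → countF f < countF g
  countF-mono-< {suc n} {f} {g} f⊆g zero gⱼ ¬fⱼ with f zero | g zero
  ... | false | true  = s≤s (countF-mono {n} (λ i → f⊆g (suc i)))
  ... | true  | _     = ⊥-elim (¬fⱼ tt)
  ... | false | false = ⊥-elim gⱼ
  countF-mono-< {suc n} {f} {g} f⊆g (suc j) gⱼ ¬fⱼ with f zero | g zero | f⊆g zero
  ... | false | false | _ = countF-mono-< {n} (λ i → f⊆g (suc i)) j gⱼ ¬fⱼ
  ... | false | true  | _ = m≤n⇒m≤1+n (countF-mono-< {n} (λ i → f⊆g (suc i)) j gⱼ ¬fⱼ)
  ... | true  | false | k = ⊥-elim (k tt)
  ... | true  | true  | _ = s≤s (countF-mono-< {n} (λ i → f⊆g (suc i)) j gⱼ ¬fⱼ)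

  countF-pos : ∀ {n} (f : Fin n → Bool) j → T (f j) → ∃ λ k → countF f ≡ suc k
  countF-pos f zero fⱼ with f zero
  ... | true = _ , refl
  countF-pos f (suc j) fⱼ with f zero | countF-pos (λ i → f (suc i)) j fⱼ
  ... | true  | _ = _ , refl
  ... | false | k , eq = k , eq

  isMin-intro : ∀ {N} {R : Rel N} {m} → T (R m m) → (∀ z → T (R z m) → z ≡ m) → T (isMin R m)
  isMin-intro Rmm minimal = ∧-intro Rmm (allF-intro (λ z → ⇒ᵇ-intro (λ Rzm → ≡⇒== (minimal z Rzm))))

  isMin-ground : ∀ {N} {R : Rel N} {m} → T (isMin R m) → T (R m m)
  isMin-ground t = ∧-fst t

  isMin-minimal : ∀ {N} {R : Rel N} {m} → T (isMin R m) → ∀ z → T (R z m) → z ≡ m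
  isMin-minimal {R = R} {m} t z Rzm = ==⇒≡ (⇒ᵇ-elim (allF-elim (∧-snd {R m m} t) z) Rzm)

  module _ {N : ℕ} {R : Rel N} (po : IsPoset R) where
    open IsPoset po renaming (trans to ≤-trans)

    ≤-groundˡ : ∀ {x y} → T (R x y) → T (R x x)
    ≤-groundˡ {x} {y} Rxy = proj₁ (onGround x y Rxy)

    ≤-groundʳ : ∀ {x y} → T (R x y) → T (R y y)
    ≤-groundʳ {x} {y} Rxy = proj₂ (onGround x y Rxy)

    minimal-below′ : ∀ y → Acc _<_ (countF (λ z → R z y)) → T (R y y) → ∃ λ m → T (isMin R m) × T (R m y)
    minimal-below′ y (acc rs) Ryy with T-cases (isMin R y)
    ... | inj₁ min-y = y , min-y , Ryy
    ... | inj₂ ¬min-y with allF-counterexample (λ all → ¬min-y (∧-intro Ryy all))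
    ... | z , ¬z⇒y with ⇒ᵇ-counterexample ¬z⇒y
    ... | Rzy , z≢y with minimal-below′ z (rs fewer-below-z) (≤-groundˡ Rzy)
      where
      fewer-below-z : countF (λ u → R u z) < countF (λ u → R u y)
      fewer-below-z = countF-mono-< (λ u Ruz → ≤-trans u z y Ruz Rzy) y Ryy
                                     (λ Ryz → z≢y (≡⇒== (antisym z y Rzy Ryz)))
    ... | m , min-m , Rmz = m , min-m , ≤-trans m z y Rmz Rzy

    minimal-below : ∀ y → T (R y y) → ∃ λ m → T (isMin R m) × T (R m y)
    minimal-below y = minimal-below′ y (<-wellFounded _)

open FiniteOrder

-- The order of P ↘ᵥ Q in closed form: everything of Q below v lies below all of P.
graftRel : ∀ {N} → Rel N → Fin N → Rel N → Rel N
graftRel P v Q x y = P x y ∨ (Q x y ∨ (Q x v ∧ P y y))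

data GraftCases {N} (P : Rel N) (v : Fin N) (Q : Rel N) (x y : Fin N) : Set where
  inP    : T (P x y) → GraftCases P v Q x y
  inQ    : T (Q x y) → GraftCases P v Q x y
  across : T (Q x v) → T (P y y) → GraftCases P v Q x y

module GraftOrder {N : ℕ} {P Q : Rel N} (pp : IsPoset P) (pq : IsPoset Q) (P∩Q=∅ : Disjoint P Q)
                  (v : Fin N) (Qvv : T (Q v v)) where
  open IsPoset pp using () renaming (trans to P-trans)
  open IsPoset pq using () renaming (trans to Q-trans; antisym to Q-antisym)

  G : Rel N
  G = graftRel P v Q

  graft-cases : ∀ {x y} → T (G x y) → GraftCases P v Q x y
  graft-cases {x} {y} t with ∨-cases {P x y} t
  ... | inj₁ Pxy = inP Pxy
  ... | inj₂ t′ with ∨-cases {Q x y} t′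
  ... | inj₁ Qxy = inQ Qxy
  ... | inj₂ t″ = across (∧-fst t″) (∧-snd {Q x v} t″)

  graft-P : ∀ {x y} → T (P x y) → T (G x y)
  graft-P t = ∨-inl t

  graft-Q : ∀ {x y} → T (Q x y) → T (G x y)
  graft-Q {x} {y} t = ∨-inr {P x y} (∨-inl t)

  graft-across : ∀ {x y} → T (Q x v) → T (P y y) → T (G x y)
  graft-across {x} {y} Qxv Pyy = ∨-inr {P x y} (∨-inr {Q x y} (∧-intro Qxv Pyy))

  P≢Q : ∀ {x y} → T (P x x) → T (Q y y) → ¬ x ≡ y
  P≢Q Pxx Qyy refl = P∩Q=∅ _ Pxx Qyy

  graft-trans : ∀ {x y z} → T (G x y) → T (G y z) → T (G x z)
  graft-trans {y = y} Gxy Gyz with graft-cases Gxy | graft-cases Gyz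
  ... | inP Pxy       | inP Pyz       = graft-P (P-trans _ _ _ Pxy Pyz)
  ... | inQ Qxy       | inQ Qyz       = graft-Q (Q-trans _ _ _ Qxy Qyz)
  ... | inQ Qxy       | across Qyv Pz = graft-across (Q-trans _ _ _ Qxy Qyv) Pz
  ... | across Qxv _  | inP Pyz       = graft-across Qxv (≤-groundʳ pp Pyz)
  ... | inP Pxy       | inQ Qyz       = ⊥-elim (P∩Q=∅ y (≤-groundʳ pp Pxy) (≤-groundˡ pq Qyz))
  ... | inP Pxy       | across Qyv _  = ⊥-elim (P∩Q=∅ y (≤-groundʳ pp Pxy) (≤-groundˡ pq Qyv))
  ... | inQ Qxy       | inP Pyz       = ⊥-elim (P∩Q=∅ y (≤-groundˡ pp Pyz) (≤-groundʳ pq Qxy))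
  ... | across _ Pyy  | inQ Qyz       = ⊥-elim (P∩Q=∅ y Pyy (≤-groundˡ pq Qyz))
  ... | across _ Pyy  | across Qyv _  = ⊥-elim (P∩Q=∅ y Pyy (≤-groundˡ pq Qyv))

  graft-fromP : ∀ {x y} → T (P x x) → T (G x y) → T (P x y)
  graft-fromP Pxx Gxy with graft-cases Gxy
  ... | inP Pxy = Pxy
  ... | inQ Qxy = ⊥-elim (P∩Q=∅ _ Pxx (≤-groundˡ pq Qxy))
  ... | across Qxv _ = ⊥-elim (P∩Q=∅ _ Pxx (≤-groundˡ pq Qxv))

  graft-toQ : ∀ {x y} → T (Q y y) → T (G x y) → T (Q x y)
  graft-toQ Qyy Gxy with graft-cases Gxy
  ... | inP Pxy = ⊥-elim (P∩Q=∅ _ (≤-groundʳ pp Pxy) Qyy)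
  ... | inQ Qxy = Qxy
  ... | across _ Pyy = ⊥-elim (P∩Q=∅ _ Pyy Qyy)

  graft-fromQ : ∀ {x y} → T (Q x x) → T (G x y) → T (Q x y) ⊎ (T (Q x v) × T (P y y))
  graft-fromQ Qxx Gxy with graft-cases Gxy
  ... | inP Pxy = ⊥-elim (P∩Q=∅ _ (≤-groundˡ pp Pxy) Qxx)
  ... | inQ Qxy = inj₁ Qxy
  ... | across Qxv Pyy = inj₂ (Qxv , Pyy)

  isMin-graft : ∀ x → isMin G x ≡ isMin Q x
  isMin-graft x = T-ext to from
    where
    v-below : ∀ {x} → T (P x x) → T (isMin G x) → ⊥
    v-below Pxx min-x = P≢Q Pxx Qvv (sym (isMin-minimal {R = G} min-x v (graft-across Qvv Pxx)))
    to : T (isMin G x) → T (isMin Q x)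
    to min-x with graft-cases (isMin-ground {R = G} min-x)
    ... | inP Pxx = ⊥-elim (v-below (≤-groundˡ pp Pxx) min-x)
    ... | across _ Pxx = ⊥-elim (v-below Pxx min-x)
    ... | inQ Qxx = isMin-intro {R = Q} Qxx (λ z Qzx → isMin-minimal {R = G} min-x z (graft-Q Qzx))
    from : T (isMin Q x) → T (isMin G x)
    from min-x = isMin-intro {R = G} (graft-Q Qxx) (λ z Gzx → isMin-minimal {R = Q} min-x z (graft-toQ Qxx Gzx))
      where
      Qxx : T (Q x x)
      Qxx = isMin-ground {R = Q} min-x

  private
    generators : Rel N
    generators x y = P x y ∨ Q x y ∨ ((x == v) ∧ isMin P y)

    generator⇒graft : ∀ {x y} → T (generators x y) → T (G x y)
    generator⇒graft {x} {y} t with ∨-cases {P x y} t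
    ... | inj₁ Pxy = graft-P Pxy
    ... | inj₂ t′ with ∨-cases {Q x y} t′
    ... | inj₁ Qxy = graft-Q Qxy
    ... | inj₂ t″ = graft-across (subst (λ u → T (Q u v)) (sym (==⇒≡ (∧-fst t″))) Qvv)
                                 (isMin-ground {R = P} (∧-snd {x == v} t″))

    walk⇒graft : ∀ {x y n} → Walk generators x y (suc n) → T (G x y)
    walk⇒graft (cons e nil) = generator⇒graft e
    walk⇒graft (cons e (cons e′ p)) = graft-trans (generator⇒graft e) (walk⇒graft (cons e′ p))

    -- Across an edge x ≤_Q v < y, pass through v and a minimal element of P below y.
    graft⇒Plus : ∀ {x y} → T (G x y) → Plus generators x y
    graft⇒Plus {x} {y} Gxy with graft-cases Gxy
    ... | inP Pxy = Plus-edge (∨-inl Pxy)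
    ... | inQ Qxy = Plus-edge (∨-inr {P x y} (∨-inl Qxy))
    ... | across Qxv Pyy with minimal-below pp y Pyy
    ... | m , min-m , Pmy =
      Plus-trans (Plus-edge (∨-inr {P x v} (∨-inl Qxv)))
        (Plus-trans (Plus-edge (∨-inr {P v m} (∨-inr {Q v m} (∧-intro {v == v} (≡⇒== refl) min-m))))
                    (Plus-edge (∨-inl Pmy)))

  graftAt≐graftRel : graftAt P v Q ≐ G
  graftAt≐graftRel x y = T-ext (λ t → walk⇒graft (proj₂ (closure-sound generators t)))
                               (λ Gxy → closure-complete generators (graft⇒Plus Gxy))

module _ {N : ℕ} (R : Rel N) (S : Sub N) where
  restrict-intro : ∀ {x y} → T (R x y) → T (S x) → T (S y) → T (restrict R S x y)
  restrict-intro Rxy Sx Sy = ∧-intro Rxy (∧-intro Sx Sy)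

  restrict-rel : ∀ {x y} → T (restrict R S x y) → T (R x y)
  restrict-rel t = ∧-fst t

  restrict-dom : ∀ {x y} → T (restrict R S x y) → T (S x)
  restrict-dom {x} {y} t = ∧-fst (∧-snd {R x y} t)

  restrict-cod : ∀ {x y} → T (restrict R S x y) → T (S y)
  restrict-cod {x} {y} t = ∧-snd {S x} (∧-snd {R x y} t)

  restrict-ground : ∀ {x} → T (R x x) → T (S x) → T (restrict R S x x)
  restrict-ground Rxx Sx = restrict-intro Rxx Sx Sx

restrict-isPoset : ∀ {N} {R : Rel N} (S : Sub N) → IsPoset R → IsPoset (restrict R S)
restrict-isPoset {R = R} S po = record
  { onGround = λ x y r → restrict-ground R S (≤-groundˡ po (restrict-rel R S r)) (restrict-dom R S r)
                       , restrict-ground R S (≤-groundʳ po (restrict-rel R S r)) (restrict-cod R S r)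
  ; antisym = λ x y r r′ → antisym x y (restrict-rel R S r) (restrict-rel R S r′)
  ; trans = λ x y z r r′ → restrict-intro R S (≤-trans x y z (restrict-rel R S r) (restrict-rel R S r′))
                                              (restrict-dom R S r) (restrict-cod R S r′)
  }
  where open IsPoset po renaming (trans to ≤-trans)

restrict-disjoint : ∀ {N} {P Q : Rel N} (S : Sub N) → Disjoint P Q → Disjoint P (restrict Q S)
restrict-disjoint {Q = Q} S P∩Q=∅ x Pxx r = P∩Q=∅ x Pxx (restrict-rel Q S r)

module _ {N : ℕ} {R : Rel N} where
  comparableB-inl : ∀ {x y} → T (R x y) → T (comparableB R x y)
  comparableB-inl t = ∨-inl t

  comparableB-inr : ∀ {x y} → T (R y x) → T (comparableB R x y)
  comparableB-inr {x} {y} t = ∨-inr {R x y} t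

  comparableB-cases : ∀ {x y} → T (comparableB R x y) → T (R x y) ⊎ T (R y x)
  comparableB-cases {x} {y} t = ∨-cases {R x y} t

  comparableB-sym : ∀ x y → T (comparableB R x y) → T (comparableB R y x)
  comparableB-sym x y t with comparableB-cases t
  ... | inj₁ Rxy = comparableB-inr Rxy
  ... | inj₂ Ryx = comparableB-inl Ryx

  Chain⇒Star : ∀ {x y} → Chain R x y → Star {R = comparableB R} x y
  Chain⇒Star here = inj₁ refl
  Chain⇒Star (step (inj₁ Rxy) c) = Star-trans (inj₂ (Plus-edge (comparableB-inl Rxy))) (Chain⇒Star c)
  Chain⇒Star (step (inj₂ Ryx) c) = Star-trans (inj₂ (Plus-edge (comparableB-inr Ryx))) (Chain⇒Star c)

  Plus-crossing : (S : Sub N) → ∀ {x y} → Plus R x y → T (S x) → ¬ T (S y) →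
                  ∃ λ a → ∃ λ b → T (S a) × ¬ T (S b) × T (R a b)
  Plus-crossing S (n , p) = go p
    where
    go : ∀ {x y n} → Walk R x y n → T (S x) → ¬ T (S y) → ∃ λ a → ∃ λ b → T (S a) × ¬ T (S b) × T (R a b)
    go nil Sx ¬Sy = ⊥-elim (¬Sy Sx)
    go (cons {y = y} e p) Sx ¬Sz with T-cases (S y)
    ... | inj₁ Sy = go p Sy ¬Sz
    ... | inj₂ ¬Sy = _ , _ , Sx , ¬Sy , e

Connected : ∀ {N} → Rel N → Set
Connected R = (∃ λ x → T (R x x)) × (∀ x y → T (R x x) → T (R y y) → Plus (comparableB R) x y)

connectedB-sound : ∀ {N} {R : Rel N} → T (connectedB R) → Connected R
connectedB-sound {R = R} t =
  anyF-elim (∧-fst t) ,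
  λ x y Rxx Ryy → closure-sound (comparableB R)
    (⇒ᵇ-elim (allF-elim (allF-elim (∧-snd {anyF (λ x → R x x)} t) x) y) (∧-intro Rxx Ryy))

connectedB-complete : ∀ {N} {R : Rel N} → Connected R → T (connectedB R)
connectedB-complete {R = R} ((x , Rxx) , connect) =
  ∧-intro (anyF-intro x Rxx)
    (allF-intro (λ a → allF-intro (λ b → ⇒ᵇ-intro (λ t →
      closure-complete (comparableB R) (connect a b (∧-fst t) (∧-snd {R a a} t))))))

Above : ∀ {N} → Rel N → Fin N → Sub N
Above R w x = R w x ∧ not (w == x)

Above-intro : ∀ {N} {R : Rel N} {w x} → T (R w x) → ¬ w ≡ x → T (Above R w x)
Above-intro Rwx w≢x = ∧-intro Rwx (≢⇒not== w≢x)

Above-elim : ∀ {N} {R : Rel N} {w x} → T (Above R w x) → T (R w x) × ¬ w ≡ x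
Above-elim {R = R} {w} {x} t = ∧-fst t , λ w≡x → not-elim (∧-snd {R w x} t) (≡⇒== w≡x)

-- I ⊚ R witnessed by w, in propositional form.
record Admissible {N : ℕ} (R : Rel N) (I : Sub N) (w : Fin N) : Set where
  field
    min-w      : T (isMin R w)
    below-is-w : ∀ x → T (Iminus R I x) → x ≡ w
    w-below    : T (Iminus R I w)
    ⊆above     : ∀ x → T (I x) → T (Above R w x)
    connected  : Connected (restrict R I)
    closed     : ∀ x y → T (I x) → T (Above R w y) → ¬ T (I y) → ¬ T (comparableB R x y)

module _ {N : ℕ} {R : Rel N} {I : Sub N} where
  Iminus-intro : ∀ {x y} → ¬ T (I x) → T (I y) → T (R x y) → T (Iminus R I x)
  Iminus-intro {x} {y} ¬Ix Iy Rxy = ∧-intro (not-intro ¬Ix) (anyF-intro {f = λ u → I u ∧ R x u} y (∧-intro Iy Rxy))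

  Iminus-elim : ∀ {x} → T (Iminus R I x) → ¬ T (I x) × ∃ λ y → T (I y) × T (R x y)
  Iminus-elim {x} t with anyF-elim (∧-snd {not (I x)} t)
  ... | y , u = not-elim (∧-fst t) , y , ∧-fst u , ∧-snd {I y} u

  circ-sound : T (circ R I) → ∃ λ w → Admissible R I w
  circ-sound t with anyF-elim t
  ... | w , u = w , record
      { min-w = ∧-fst u
      ; below-is-w = λ x t → ==⇒≡ (subst T (xnor⇒≡ (allF-elim Iminus≡w x)) t)
      ; w-below = subst T (sym (xnor⇒≡ (allF-elim Iminus≡w w))) (≡⇒== refl)
      ; ⊆above = λ x → ⇒ᵇ-elim (allF-elim ⊆above′ x)
      ; connected = connectedB-sound {R = restrict R I} (∧-fst separated)
      ; closed = λ x y Ix above-y ¬Iy →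
          not-elim (⇒ᵇ-elim (allF-elim (allF-elim (∧-snd {connectedB (restrict R I)} separated) x) y)
                            (∧-intro Ix (∧-intro above-y (not-intro ¬Iy))))
      }
    where
    Iminus≡w : T (allF (λ x → not (Iminus R I x xor (x == w))))
    Iminus≡w = ∧-fst (∧-snd {isMin R w} u)
    component : T (allF (λ x → I x ⇒ᵇ Above R w x) ∧ connectedB (restrict R I) ∧
                   allF (λ x → allF (λ y → (I x ∧ Above R w y ∧ not (I y)) ⇒ᵇ not (comparableB R x y))))
    component = ∧-snd {allF (λ x → not (Iminus R I x xor (x == w)))} (∧-snd {isMin R w} u)
    ⊆above′ : T (allF (λ x → I x ⇒ᵇ Above R w x))
    ⊆above′ = ∧-fst component
    separated : T (connectedB (restrict R I) ∧ allF (λ x → allF (λ y → (I x ∧ Above R w y ∧ not (I y)) ⇒ᵇ not (comparableB R x y))))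
    separated = ∧-snd {allF (λ x → I x ⇒ᵇ Above R w x)} component

  circ-complete : ∀ {w} → Admissible R I w → T (circ R I)
  circ-complete {w} adm =
    anyF-intro w (∧-intro min-w (∧-intro Iminus≡w (∧-intro ⊆above′
      (∧-intro (connectedB-complete {R = restrict R I} connected) closed′))))
    where
    open Admissible adm
    Iminus≡w : T (allF (λ x → not (Iminus R I x xor (x == w))))
    Iminus≡w = allF-intro (λ x → ≡⇒xnor (T-ext (λ t → ≡⇒== (below-is-w x t))
                                               (λ x=w → subst (λ u → T (Iminus R I u)) (sym (==⇒≡ x=w)) w-below)))
    ⊆above′ : T (allF (λ x → I x ⇒ᵇ Above R w x))
    ⊆above′ = allF-intro (λ x → ⇒ᵇ-intro (⊆above x))
    closed′ : T (allF (λ x → allF (λ y → (I x ∧ Above R w y ∧ not (I y)) ⇒ᵇ not (comparableB R x y))))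
    closed′ = allF-intro (λ x → allF-intro (λ y → ⇒ᵇ-intro (λ t →
      not-intro (closed x y (∧-fst t) (∧-fst (∧-snd {I x} t)) (not-elim (∧-snd {Above R w y} (∧-snd {I x} t)))))))

connectedB-cong : ∀ {N} {R R′ : Rel N} → R ≐ R′ → connectedB R ≡ connectedB R′
connectedB-cong R≐R′ = cong₂ _∧_ (anyF-cong (λ x → R≐R′ x x))
  (allF-cong (λ x → allF-cong (λ y → cong₂ _⇒ᵇ_ (cong₂ _∧_ (R≐R′ x x) (R≐R′ y y))
     (closure-cong _ (λ a b → cong₂ _∨_ (R≐R′ a b) (R≐R′ b a)) x y))))

module _ {N : ℕ} {R R′ : Rel N} (R≐R′ : R ≐ R′) where
  isMin-cong : isMin R ≗ isMin R′
  isMin-cong w = cong₂ _∧_ (R≐R′ w w) (allF-cong (λ z → cong (_⇒ᵇ (z == w)) (R≐R′ z w)))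

  numMin-cong : numMin R ≡ numMin R′
  numMin-cong = countF-cong isMin-cong

  module _ {I I′ : Sub N} (I≗I′ : I ≗ I′) where
    restrict-cong : restrict R I ≐ restrict R′ I′
    restrict-cong x y = cong₂ _∧_ (R≐R′ x y) (cong₂ _∧_ (I≗I′ x) (I≗I′ y))

    circ-cong : circ R I ≡ circ R′ I′
    circ-cong = anyF-cong (λ w → cong₂ _∧_ (isMin-cong w) (cong₂ _∧_
      (allF-cong (λ x → cong (λ b → not (b xor (x == w))) (Iminus-cong x)))
      (cong₂ _∧_ (allF-cong (λ x → cong₂ _⇒ᵇ_ (I≗I′ x) (Above-cong w x)))
        (cong₂ _∧_ (connectedB-cong restrict-cong)
          (allF-cong (λ x → allF-cong (λ y →
            cong₂ _⇒ᵇ_ (cong₂ _∧_ (I≗I′ x) (cong₂ _∧_ (Above-cong w y) (cong not (I≗I′ y))))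
                       (cong not (cong₂ _∨_ (R≐R′ x y) (R≐R′ y x))))))))))
      where
      Iminus-cong : Iminus R I ≗ Iminus R′ I′
      Iminus-cong x = cong₂ _∧_ (cong not (I≗I′ x)) (anyF-cong (λ y → cong₂ _∧_ (I≗I′ y) (R≐R′ x y)))
      Above-cong : ∀ w → Above R w ≗ Above R′ w
      Above-cong w x = cong (_∧ not (w == x)) (R≐R′ w x)

eqRel-congʳ : ∀ {N} {A X X′ : Rel N} → X ≐ X′ → eqRel A X ≡ eqRel A X′
eqRel-congʳ {A = A} X≐X′ = allF-cong (λ x → allF-cong (λ y → cong (λ b → not (A x y xor b)) (X≐X′ x y)))

-- The cut of P ↘ᵥ Q induced by a cut J of Q.
extendCut : ∀ {N} → Rel N → Fin N → Sub N → Sub N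
extendCut P v J x = J x ∨ (J v ∧ P x x)

extendCut-cong : ∀ {N} {P : Rel N} {v} {J J′ : Sub N} → J ≗ J′ → extendCut P v J ≗ extendCut P v J′
extendCut-cong {P = P} {v} J≗J′ x = cong₂ _∨_ (J≗J′ x) (cong (_∧ P x x) (J≗J′ v))

module GraftCuts {N : ℕ} {P Q : Rel N} (pp : IsPoset P) (pq : IsPoset Q) (P-connected : IsConnected P)
                 (P∩Q=∅ : Disjoint P Q) (v : Fin N) (Qvv : T (Q v v)) where
  open GraftOrder pp pq P∩Q=∅ v Qvv
  open IsPoset pq using () renaming (trans to Q-trans; antisym to Q-antisym)

  module _ (J : Sub N) where
    extendCut-inl : ∀ {x} → T (J x) → T (extendCut P v J x)
    extendCut-inl Jx = ∨-inl Jx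

    extendCut-inr : ∀ {x} → T (J v) → T (P x x) → T (extendCut P v J x)
    extendCut-inr {x} Jv Pxx = ∨-inr {J x} (∧-intro Jv Pxx)

    extendCut-cases : ∀ {x} → T (extendCut P v J x) → T (J x) ⊎ (T (J v) × T (P x x))
    extendCut-cases {x} t with ∨-cases {J x} t
    ... | inj₁ Jx = inj₁ Jx
    ... | inj₂ t′ = inj₂ (∧-fst t′ , ∧-snd {J v} t′)

    extendCut-absent : ¬ T (J v) → extendCut P v J ≗ J
    extendCut-absent ¬Jv x = T-ext from-cases extendCut-inl
      where
      from-cases : T (extendCut P v J x) → T (J x)
      from-cases t with extendCut-cases t
      ... | inj₁ Jx = Jx
      ... | inj₂ (Jv , _) = ⊥-elim (¬Jv Jv)

  p₀ : Fin N
  p₀ = proj₁ (proj₁ P-connected)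

  Pp₀ : T (P p₀ p₀)
  Pp₀ = proj₂ (proj₁ P-connected)

  ground-admissible : T (isMin Q v) → Admissible G (ground P) v
  ground-admissible min-v = record
    { min-w = subst T (sym (isMin-graft v)) min-v
    ; below-is-w = below-is-v
    ; w-below = Iminus-intro {R = G} {I = ground P} (λ Pvv → P∩Q=∅ v Pvv Qvv) Pp₀ (graft-across Qvv Pp₀)
    ; ⊆above = λ x Pxx → Above-intro {R = G} (graft-across Qvv Pxx) (λ v≡x → P≢Q Pxx Qvv (sym v≡x))
    ; connected = (p₀ , restrict-ground G (ground P) (graft-P Pp₀) Pp₀) , connect
    ; closed = closed
    }
    where
    below-is-v : ∀ x → T (Iminus G (ground P) x) → x ≡ v
    below-is-v x t with Iminus-elim {R = G} {I = ground P} t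
    ... | ¬Pxx , y , Pyy , Gxy with graft-cases Gxy
    ... | inP Pxy = ⊥-elim (¬Pxx (≤-groundˡ pp Pxy))
    ... | inQ Qxy = ⊥-elim (P∩Q=∅ y Pyy (≤-groundʳ pq Qxy))
    ... | across Qxv _ = isMin-minimal {R = Q} min-v x Qxv
    P⇒restrict : ∀ {a b} → T (P a b) → T (restrict G (ground P) a b)
    P⇒restrict Pab = restrict-intro G (ground P) (graft-P Pab) (≤-groundˡ pp Pab) (≤-groundʳ pp Pab)
    connect : ∀ x y → T (restrict G (ground P) x x) → T (restrict G (ground P) y y) →
              Plus (comparableB (restrict G (ground P))) x y
    connect x y Gx Gy with Chain⇒Star (proj₂ P-connected x y (restrict-dom G (ground P) Gx) (restrict-dom G (ground P) Gy))
    ... | inj₁ refl = Plus-edge (comparableB-inl {R = restrict G (ground P)} Gx)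
    ... | inj₂ path = Plus-mono (λ a b c → lift (comparableB-cases {R = P} c)) path
      where
      lift : ∀ {a b} → T (P a b) ⊎ T (P b a) → T (comparableB (restrict G (ground P)) a b)
      lift (inj₁ Pab) = comparableB-inl {R = restrict G (ground P)} (P⇒restrict Pab)
      lift (inj₂ Pba) = comparableB-inr {R = restrict G (ground P)} (P⇒restrict Pba)
    closed : ∀ x y → T (P x x) → T (Above G v y) → ¬ T (P y y) → ¬ T (comparableB G x y)
    closed x y Pxx above-y ¬Pyy c with comparableB-cases {R = G} c
    ... | inj₁ Gxy = ¬Pyy (≤-groundʳ pp (graft-fromP Pxx Gxy))
    ... | inj₂ Gyx with graft-cases Gyx
    ... | inP Pyx = ¬Pyy (≤-groundˡ pp Pyx)
    ... | inQ Qyx = P∩Q=∅ x Pxx (≤-groundʳ pq Qyx)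
    ... | across Qyv _ with graft-cases (proj₁ (Above-elim {R = G} above-y))
    ...   | inP Pvy = P∩Q=∅ v (≤-groundˡ pp Pvy) Qvv
    ...   | inQ Qvy = proj₂ (Above-elim {R = G} above-y) (Q-antisym v y Qvy Qyv)
    ...   | across _ Pyy = ¬Pyy Pyy

  module ExtendedCut {J : Sub N} {w : Fin N} (adm : Admissible Q J w) where
    open Admissible adm
    I : Sub N
    I = extendCut P v J

    Qww : T (Q w w)
    Qww = isMin-ground {R = Q} min-w

    J⊆Q : ∀ {x} → T (J x) → T (Q x x)
    J⊆Q {x} Jx = ≤-groundʳ pq (proj₁ (Above-elim {R = Q} (⊆above x Jx)))

    ¬Iw : ¬ T (I w)
    ¬Iw Iw with extendCut-cases J Iw
    ... | inj₁ Jw = proj₁ (Iminus-elim {R = Q} {I = J} w-below) Jw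
    ... | inj₂ (_ , Pww) = P∩Q=∅ w Pww Qww

    extended-below-is-w : ∀ x → T (Iminus G I x) → x ≡ w
    extended-below-is-w x t with Iminus-elim {R = G} {I = I} t
    ... | ¬Ix , y , Iy , Gxy = below-is-w x (Iminus-Q (extendCut-cases J Iy))
      where
      ¬Jx : ¬ T (J x)
      ¬Jx Jx = ¬Ix (extendCut-inl J Jx)
      Iminus-Q : T (J y) ⊎ (T (J v) × T (P y y)) → T (Iminus Q J x)
      Iminus-Q (inj₁ Jy) = Iminus-intro {R = Q} {I = J} ¬Jx Jy (graft-toQ (J⊆Q Jy) Gxy)
      Iminus-Q (inj₂ (Jv , Pyy)) with graft-cases Gxy
      ... | inP Pxy = ⊥-elim (¬Ix (extendCut-inr J Jv (≤-groundˡ pp Pxy)))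
      ... | inQ Qxy = ⊥-elim (P∩Q=∅ y Pyy (≤-groundʳ pq Qxy))
      ... | across Qxv _ = Iminus-intro {R = Q} {I = J} ¬Jx Jv Qxv

    extended-w-below : T (Iminus G I w)
    extended-w-below with Iminus-elim {R = Q} {I = J} w-below
    ... | _ , y , Jy , Qwy = Iminus-intro {R = G} {I = I} ¬Iw (extendCut-inl J Jy) (graft-Q Qwy)

    extended-⊆above : ∀ x → T (I x) → T (Above G w x)
    extended-⊆above x Ix with extendCut-cases J Ix
    ... | inj₁ Jx = let (Qwx , w≢x) = Above-elim {R = Q} (⊆above x Jx) in Above-intro {R = G} (graft-Q Qwx) w≢x
    ... | inj₂ (Jv , Pxx) = Above-intro {R = G} (graft-across (proj₁ (Above-elim {R = Q} (⊆above v Jv))) Pxx)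
                                                (λ w≡x → P≢Q Pxx Qww (sym w≡x))

    C : Rel N
    C = comparableB (restrict G I)

    J-path⇒I-path : ∀ {a b} → Plus (comparableB (restrict Q J)) a b → Plus C a b
    J-path⇒I-path = Plus-mono (λ a b c → lift (comparableB-cases {R = restrict Q J} c))
      where
      Q⇒G : ∀ {a b} → T (restrict Q J a b) → T (restrict G I a b)
      Q⇒G r = restrict-intro G I (graft-Q (restrict-rel Q J r)) (extendCut-inl J (restrict-dom Q J r))
                                                                 (extendCut-inl J (restrict-cod Q J r))
      lift : ∀ {a b} → T (restrict Q J a b) ⊎ T (restrict Q J b a) → T (C a b)
      lift (inj₁ r) = comparableB-inl {R = restrict G I} (Q⇒G r)
      lift (inj₂ r) = comparableB-inr {R = restrict G I} (Q⇒G r)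

    J-ground : ∀ {x} → T (J x) → T (restrict Q J x x)
    J-ground Jx = restrict-ground Q J (J⊆Q Jx) Jx

    path-to-v : ∀ {z} → T (J v) → T (I z) → Plus C z v
    path-to-v {z} Jv Iz with extendCut-cases J Iz
    ... | inj₁ Jz = J-path⇒I-path (proj₂ connected z v (J-ground Jz) (J-ground Jv))
    ... | inj₂ (_ , Pzz) = Plus-edge (comparableB-inr {R = restrict G I} (restrict-intro G I (graft-across Qvv Pzz) (extendCut-inl J Jv) Iz))

    extended-connected : Connected (restrict G I)
    extended-connected = (x₀ , restrict-ground G I (graft-Q (J⊆Q Jx₀)) (extendCut-inl J Jx₀)) , connect
      where
      x₀ : Fin N
      x₀ = proj₁ (proj₁ connected)
      Jx₀ : T (J x₀)
      Jx₀ = restrict-dom Q J (proj₂ (proj₁ connected))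
      connect : ∀ x y → T (restrict G I x x) → T (restrict G I y y) → Plus C x y
      connect x y Gx Gy with T-cases (J v)
      ... | inj₁ Jv = Plus-trans (path-to-v Jv (restrict-dom G I Gx))
                                 (Plus-sym (comparableB-sym {R = restrict G I}) (path-to-v Jv (restrict-dom G I Gy)))
      ... | inj₂ ¬Jv = J-path⇒I-path (proj₂ connected x y (J-ground (only-J (restrict-dom G I Gx)))
                                                          (J-ground (only-J (restrict-dom G I Gy))))
        where
        only-J : ∀ {z} → T (I z) → T (J z)
        only-J Iz = subst T (extendCut-absent J ¬Jv _) Iz

    extended-closed : ∀ x y → T (I x) → T (Above G w y) → ¬ T (I y) → ¬ T (comparableB G x y)
    extended-closed x y Ix above-y ¬Iy c with Above-elim {R = G} above-y
    ... | Gwy , w≢y with graft-fromQ Qww Gwy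
    ... | inj₂ (Qwv , Pyy) = P-side (extendCut-cases J Ix)
      where
      P-side : T (J x) ⊎ (T (J v) × T (P x x)) → ⊥
      P-side (inj₂ (Jv , _)) = ¬Iy (extendCut-inr J Jv Pyy)
      P-side (inj₁ Jx) with comparableB-cases {R = G} c
      ... | inj₂ Gyx = P∩Q=∅ x (≤-groundʳ pp (graft-fromP Pyy Gyx)) (J⊆Q Jx)
      ... | inj₁ Gxy with graft-fromQ (J⊆Q Jx) Gxy
      ...   | inj₁ Qxy = P∩Q=∅ y Pyy (≤-groundʳ pq Qxy)
      ...   | inj₂ (Qxv , _) with w ≟ᶠ v
      ...     | yes refl = proj₂ (Above-elim {R = Q} (⊆above x Jx)) (sym (isMin-minimal {R = Q} min-w x Qxv))
      ...     | no w≢v = closed x v Jx (Above-intro {R = Q} Qwv w≢v) (λ Jv → ¬Iy (extendCut-inr J Jv Pyy))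
                                (comparableB-inl {R = Q} Qxv)
    ... | inj₁ Qwy = Q-side (extendCut-cases J Ix)
      where
      ¬Jy : ¬ T (J y)
      ¬Jy Jy = ¬Iy (extendCut-inl J Jy)
      above-Q : T (Above Q w y)
      above-Q = Above-intro {R = Q} Qwy w≢y
      Qyy : T (Q y y)
      Qyy = ≤-groundʳ pq Qwy
      Q-side : T (J x) ⊎ (T (J v) × T (P x x)) → ⊥
      Q-side (inj₁ Jx) with comparableB-cases {R = G} c
      ... | inj₁ Gxy = closed x y Jx above-Q ¬Jy (comparableB-inl {R = Q} (graft-toQ Qyy Gxy))
      ... | inj₂ Gyx = closed x y Jx above-Q ¬Jy (comparableB-inr {R = Q} (graft-toQ (J⊆Q Jx) Gyx))
      Q-side (inj₂ (Jv , Pxx)) with comparableB-cases {R = G} c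
      ... | inj₁ Gxy = P∩Q=∅ y (≤-groundʳ pp (graft-fromP Pxx Gxy)) Qyy
      ... | inj₂ Gyx with graft-fromQ Qyy Gyx
      ...   | inj₁ Qyx = P∩Q=∅ x Pxx (≤-groundʳ pq Qyx)
      ...   | inj₂ (Qyv , _) = closed v y Jv above-Q ¬Jy (comparableB-inr {R = Q} Qyv)

  extend-admissible : ∀ {J w} → Admissible Q J w → Admissible G (extendCut P v J) w
  extend-admissible {w = w} adm = record
    { min-w = subst T (sym (isMin-graft w)) (Admissible.min-w adm)
    ; below-is-w = extended-below-is-w
    ; w-below = extended-w-below
    ; ⊆above = extended-⊆above
    ; connected = extended-connected
    ; closed = extended-closed
    }
    where open ExtendedCut adm

  Qpart : Sub N → Sub N
  Qpart I x = I x ∧ Q x x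

  module CutOfGraft {I : Sub N} {w : Fin N} (adm : Admissible G I w) where
    open Admissible adm
    J : Sub N
    J = Qpart I

    J-intro : ∀ {x} → T (I x) → T (Q x x) → T (J x)
    J-intro Ix Qxx = ∧-intro Ix Qxx

    J⊆I : ∀ {x} → T (J x) → T (I x)
    J⊆I Jx = ∧-fst Jx

    J⊆Q : ∀ {x} → T (J x) → T (Q x x)
    J⊆Q {x} Jx = ∧-snd {I x} Jx

    J-ground : ∀ {x} → T (J x) → T (restrict Q J x x)
    J-ground Jx = restrict-ground Q J (J⊆Q Jx) Jx

    min-w-Q : T (isMin Q w)
    min-w-Q = subst T (isMin-graft w) min-w

    Qww : T (Q w w)
    Qww = isMin-ground {R = Q} min-w-Q

    above-cases : ∀ {x} → T (Above G w x) → (T (Q w x) × ¬ w ≡ x) ⊎ (T (Q w v) × T (P x x))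
    above-cases above-x with Above-elim {R = G} above-x
    ... | Gwx , w≢x with graft-fromQ Qww Gwx
    ... | inj₁ Qwx = inj₁ (Qwx , w≢x)
    ... | inj₂ Qwv×Pxx = inj₂ Qwv×Pxx

    I⊆Q∪P : ∀ {x} → T (I x) → T (Q x x) ⊎ T (P x x)
    I⊆Q∪P Ix with above-cases (⊆above _ Ix)
    ... | inj₁ (Qwx , _) = inj₁ (≤-groundʳ pq Qwx)
    ... | inj₂ (_ , Pxx) = inj₂ Pxx

    comparable-stays-in-I : ∀ {a b} → T (I a) → T (Above G w b) → T (comparableB G a b) → T (I b)
    comparable-stays-in-I {a} {b} Ia above-b c with T-cases (I b)
    ... | inj₁ Ib = Ib
    ... | inj₂ ¬Ib = ⊥-elim (closed a b Ia above-b ¬Ib c)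

    Qpart-admissible : (∀ y → T (I y) → T (P y y) → T (J v)) → Connected (restrict Q J) → Admissible Q J w
    Qpart-admissible v∈J J-connected = record
      { min-w = min-w-Q
      ; below-is-w = J-below-is-w
      ; w-below = J-w-below
      ; ⊆above = J-⊆above
      ; connected = J-connected
      ; closed = J-closed
      }
      where
      J-below-is-w : ∀ x → T (Iminus Q J x) → x ≡ w
      J-below-is-w x t with Iminus-elim {R = Q} {I = J} t
      ... | ¬Jx , y , Jy , Qxy =
        below-is-w x (Iminus-intro {R = G} {I = I} (λ Ix → ¬Jx (J-intro Ix (≤-groundˡ pq Qxy))) (J⊆I Jy) (graft-Q Qxy))
      J-w-below : T (Iminus Q J w)
      J-w-below with Iminus-elim {R = G} {I = I} w-below
      ... | ¬Iw , y , Iy , Gwy with I⊆Q∪P Iy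
      ... | inj₁ Qyy = Iminus-intro {R = Q} {I = J} (λ Jw → ¬Iw (J⊆I Jw)) (J-intro Iy Qyy) (graft-toQ Qyy Gwy)
      ... | inj₂ Pyy with graft-fromQ Qww Gwy
      ...   | inj₁ Qwy = ⊥-elim (P∩Q=∅ y Pyy (≤-groundʳ pq Qwy))
      ...   | inj₂ (Qwv , _) = Iminus-intro {R = Q} {I = J} (λ Jw → ¬Iw (J⊆I Jw)) (v∈J y Iy Pyy) Qwv
      J-⊆above : ∀ x → T (J x) → T (Above Q w x)
      J-⊆above x Jx with above-cases (⊆above x (J⊆I Jx))
      ... | inj₁ (Qwx , w≢x) = Above-intro {R = Q} Qwx w≢x
      ... | inj₂ (_ , Pxx) = ⊥-elim (P∩Q=∅ x Pxx (J⊆Q Jx))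
      J-closed : ∀ x y → T (J x) → T (Above Q w y) → ¬ T (J y) → ¬ T (comparableB Q x y)
      J-closed x y Jx above-y ¬Jy c with Above-elim {R = Q} above-y
      ... | Qwy , w≢y = closed x y (J⊆I Jx) (Above-intro {R = G} (graft-Q Qwy) w≢y)
                               (λ Iy → ¬Jy (J-intro Iy (≤-groundʳ pq Qwy))) (lift (comparableB-cases {R = Q} c))
        where
        lift : T (Q x y) ⊎ T (Q y x) → T (comparableB G x y)
        lift (inj₁ Qxy) = comparableB-inl {R = G} (graft-Q Qxy)
        lift (inj₂ Qyx) = comparableB-inr {R = G} (graft-Q Qyx)

    I⇒J-path : (∀ {x} → T (I x) → T (Q x x)) →
               ∀ {a b} → Plus (comparableB (restrict G I)) a b → Plus (comparableB (restrict Q J)) a b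
    I⇒J-path I⊆Q = Plus-mono (λ a b c → lift (comparableB-cases {R = restrict G I} c))
      where
      G⇒Q : ∀ {a b} → T (restrict G I a b) → T (restrict Q J a b)
      G⇒Q r = let Ia = restrict-dom G I r ; Ib = restrict-cod G I r in
              restrict-intro Q J (graft-toQ (I⊆Q Ib) (restrict-rel G I r)) (J-intro Ia (I⊆Q Ia)) (J-intro Ib (I⊆Q Ib))
      lift : ∀ {a b} → T (restrict G I a b) ⊎ T (restrict G I b a) → T (comparableB (restrict Q J) a b)
      lift (inj₁ r) = comparableB-inl {R = restrict Q J} (G⇒Q r)
      lift (inj₂ r) = comparableB-inr {R = restrict Q J} (G⇒Q r)

    module WithoutP (I∩P=∅ : ∀ x → T (I x) → ¬ T (P x x)) where
      I⊆Q : ∀ {x} → T (I x) → T (Q x x)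
      I⊆Q {x} Ix with I⊆Q∪P Ix
      ... | inj₁ Qxx = Qxx
      ... | inj₂ Pxx = ⊥-elim (I∩P=∅ x Ix Pxx)

      -- v ∈ J would drag p₀ into I, since p₀ lies above v and above w.
      v∉J : ¬ T (J v)
      v∉J Jv with above-cases (⊆above v (J⊆I Jv))
      ... | inj₂ (_ , Pvv) = P∩Q=∅ v Pvv Qvv
      ... | inj₁ (Qwv , _) = I∩P=∅ p₀ Ip₀ Pp₀
        where
        Ip₀ : T (I p₀)
        Ip₀ = comparable-stays-in-I (J⊆I Jv) (Above-intro {R = G} (graft-across Qwv Pp₀) (λ w≡p₀ → P≢Q Pp₀ Qww (sym w≡p₀)))
                                    (comparableB-inl {R = G} (graft-across Qvv Pp₀))

      I≗extendCut : I ≗ extendCut P v J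
      I≗extendCut x = trans (T-ext (λ Ix → J-intro Ix (I⊆Q Ix)) J⊆I) (sym (extendCut-absent J v∉J x))

      J-admissible : Admissible Q J w
      J-admissible = Qpart-admissible (λ y Iy Pyy → ⊥-elim (I∩P=∅ y Iy Pyy)) J-connected
        where
        x₀ : Fin N
        x₀ = proj₁ (proj₁ connected)
        Ix₀ : T (I x₀)
        Ix₀ = restrict-dom G I (proj₂ (proj₁ connected))
        J-connected : Connected (restrict Q J)
        J-connected = (x₀ , J-ground (J-intro Ix₀ (I⊆Q Ix₀))) , λ x y Jx Jy →
          I⇒J-path I⊆Q (proj₂ connected x y (restrict-ground G I (graft-Q (restrict-rel Q J Jx)) (J⊆I (restrict-dom Q J Jx)))
                                             (restrict-ground G I (graft-Q (restrict-rel Q J Jy)) (J⊆I (restrict-dom Q J Jy))))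

    module WithP {p : Fin N} (Ip : T (I p)) (Pp : T (P p p)) where
      Qwv : T (Q w v)
      Qwv with above-cases (⊆above p Ip)
      ... | inj₁ (Qwp , _) = ⊥-elim (P∩Q=∅ p Pp (≤-groundʳ pq Qwp))
      ... | inj₂ (Qwv , _) = Qwv

      P-above-w : ∀ {x} → T (P x x) → T (Above G w x)
      P-above-w Pxx = Above-intro {R = G} (graft-across Qwv Pxx) (λ w≡x → P≢Q Pxx Qww (sym w≡x))

      P⊆I : ∀ {x} → T (P x x) → T (I x)
      P⊆I Pxx = along (proj₂ P-connected p _ Pp Pxx) Ip
        where
        along : ∀ {a b} → Chain P a b → T (I a) → T (I b)
        along here Ia = Ia
        along (step (inj₁ Pab) c) Ia =
          along c (comparable-stays-in-I Ia (P-above-w (≤-groundʳ pp Pab)) (comparableB-inl {R = G} (graft-P Pab)))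
        along (step (inj₂ Pba) c) Ia =
          along c (comparable-stays-in-I Ia (P-above-w (≤-groundˡ pp Pba)) (comparableB-inr {R = G} (graft-P Pba)))

      module WithoutQ (I∩Q=∅ : ∀ x → T (I x) → ¬ T (Q x x)) where
        I≗ground : I ≗ ground P
        I≗ground x = T-ext I⊆P P⊆I
          where
          I⊆P : T (I x) → T (P x x)
          I⊆P Ix with I⊆Q∪P Ix
          ... | inj₁ Qxx = ⊥-elim (I∩Q=∅ x Ix Qxx)
          ... | inj₂ Pxx = Pxx

        min-v : T (isMin Q v)
        min-v = subst (λ u → T (isMin Q u)) (sym v≡w) min-w-Q
          where
          v≡w : v ≡ w
          v≡w = below-is-w v (Iminus-intro {R = G} {I = I} (λ Iv → I∩Q=∅ v Iv Qvv) Ip (graft-across Qvv Pp))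

      module WithQ {q : Fin N} (Iq : T (I q)) (Qq : T (Q q q)) where
        P⇒I : ∀ {a b} → T (P a a) → T (restrict G I a b) → T (P b b)
        P⇒I Paa r = ≤-groundʳ pp (graft-fromP Paa (restrict-rel G I r))

        -- A path inside I from q to p leaves Q along an edge a ≤ b with a ∈ Q, b ∈ P, so a ≤ v;
        -- then v ∈ I, as v is comparable with a and lies above w (unless w = v ∈ I already).
        v∈J : T (J v)
        v∈J with Plus-crossing {R = comparableB (restrict G I)} (λ x → Q x x)
                   (proj₂ connected q p (restrict-ground G I (graft-Q Qq) Iq) (restrict-ground G I (graft-P Pp) Ip))
                   Qq (λ Qpp → P∩Q=∅ p Pp Qpp)
        ... | a , b , Qaa , ¬Qbb , c with comparableB-cases {R = restrict G I} c
        ... | inj₂ r = ⊥-elim (P∩Q=∅ a (P⇒I (Pb (restrict-dom G I r)) r) Qaa)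
          where
          Pb : T (I b) → T (P b b)
          Pb Ib with I⊆Q∪P Ib
          ... | inj₁ Qbb = ⊥-elim (¬Qbb Qbb)
          ... | inj₂ Pbb = Pbb
        ... | inj₁ r with graft-fromQ Qaa (restrict-rel G I r)
        ...   | inj₁ Qab = ⊥-elim (¬Qbb (≤-groundʳ pq Qab))
        ...   | inj₂ (Qav , _) with above-cases (⊆above a (restrict-dom G I r))
        ...     | inj₂ (_ , Paa) = ⊥-elim (P∩Q=∅ a Paa Qaa)
        ...     | inj₁ (Qwa , w≢a) with w ≟ᶠ v
        ...       | yes refl = ⊥-elim (w≢a (sym (isMin-minimal {R = Q} min-w-Q a Qav)))
        ...       | no w≢v = J-intro (comparable-stays-in-I (restrict-dom G I r)
                                                            (Above-intro {R = G} (graft-Q (Q-trans _ _ _ Qwa Qav)) w≢v)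
                                                            (comparableB-inl {R = G} (graft-Q Qav)))
                                     Qvv

        I≗extendCut : I ≗ extendCut P v J
        I≗extendCut x = T-ext to-extended (λ t → from-extended (extendCut-cases J t))
          where
          to-extended : T (I x) → T (extendCut P v J x)
          to-extended Ix with I⊆Q∪P Ix
          ... | inj₁ Qxx = extendCut-inl J (J-intro Ix Qxx)
          ... | inj₂ Pxx = extendCut-inr J v∈J Pxx
          from-extended : T (J x) ⊎ (T (J v) × T (P x x)) → T (I x)
          from-extended (inj₁ Jx) = J⊆I Jx
          from-extended (inj₂ (_ , Pxx)) = P⊆I Pxx

        -- Collapse P onto v: a path in I becomes a path in J.
        collapse : Fin N → Fin N
        collapse z = if P z z then v else z

        collapse-Q : ∀ {z} → T (Q z z) → collapse z ≡ z
        collapse-Q {z} Qzz with P z z in eq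
        ... | false = refl
        ... | true = ⊥-elim (P∩Q=∅ z (subst T (sym eq) tt) Qzz)

        collapse-P : ∀ {z} → T (P z z) → collapse z ≡ v
        collapse-P {z} Pzz with P z z
        ... | true = refl

        collapse-≤ : ∀ {a b} → T (restrict G I a b) →
                     collapse a ≡ collapse b ⊎ T (restrict Q J (collapse a) (collapse b))
        collapse-≤ {a} {b} r with I⊆Q∪P (restrict-dom G I r)
        ... | inj₂ Paa = inj₁ (trans (collapse-P Paa) (sym (collapse-P (P⇒I Paa r))))
        ... | inj₁ Qaa with graft-fromQ Qaa (restrict-rel G I r)
        ...   | inj₁ Qab = inj₂ (subst₂ (λ x y → T (restrict Q J x y)) (sym (collapse-Q Qaa)) (sym (collapse-Q Qbb))
                                        (restrict-intro Q J Qab (J-intro (restrict-dom G I r) Qaa) (J-intro (restrict-cod G I r) Qbb)))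
          where
          Qbb : T (Q b b)
          Qbb = ≤-groundʳ pq Qab
        ...   | inj₂ (Qav , Pbb) = inj₂ (subst₂ (λ x y → T (restrict Q J x y)) (sym (collapse-Q Qaa)) (sym (collapse-P Pbb))
                                               (restrict-intro Q J Qav (J-intro (restrict-dom G I r) Qaa) v∈J))

        CJ : Rel N
        CJ = comparableB (restrict Q J)

        collapse-comparable : ∀ a b → T (comparableB (restrict G I) a b) → collapse a ≡ collapse b ⊎ T (CJ (collapse a) (collapse b))
        collapse-comparable a b c with comparableB-cases {R = restrict G I} c
        ... | inj₁ r = ⊎-map₂ (comparableB-inl {R = restrict Q J}) (collapse-≤ r)
        ... | inj₂ r = ⊎-map sym (comparableB-inr {R = restrict Q J}) (collapse-≤ r)

        J-connected : Connected (restrict Q J)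
        J-connected = (q , J-ground (J-intro Iq Qq)) , connect
          where
          connect : ∀ x y → T (restrict Q J x x) → T (restrict Q J y y) → Plus CJ x y
          connect x y Jx Jy with subst₂ (Star {R = CJ}) (collapse-Q Qx) (collapse-Q Qy)
                                     (Plus-image collapse collapse-comparable (proj₂ connected x y (restrict-ground G I (graft-Q Qx) Ix)
                                                                                        (restrict-ground G I (graft-Q Qy) Iy)))
            where
            Qx : T (Q x x)
            Qx = J⊆Q (restrict-dom Q J Jx)
            Qy : T (Q y y)
            Qy = J⊆Q (restrict-dom Q J Jy)
            Ix : T (I x)
            Ix = J⊆I (restrict-dom Q J Jx)
            Iy : T (I y)
            Iy = J⊆I (restrict-dom Q J Jy)
          ... | inj₁ refl = Plus-edge (comparableB-inl {R = restrict Q J} Jx)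
          ... | inj₂ path = path

        J-admissible : Admissible Q J w
        J-admissible = Qpart-admissible (λ _ _ _ → v∈J) J-connected

  admissible-cases : ∀ {I w} → Admissible G I w →
                     (I ≗ ground P × T (isMin Q v)) ⊎ (Admissible Q (Qpart I) w × I ≗ extendCut P v (Qpart I))
  admissible-cases {I} adm with anyF-cases (λ x → I x ∧ P x x)
  ... | inj₂ I∩P=∅ = inj₂ (J-admissible , I≗extendCut)
    where open CutOfGraft adm
          open WithoutP (λ x Ix Pxx → I∩P=∅ x (∧-intro Ix Pxx))
  ... | inj₁ (p , IPp) with anyF-cases (λ x → I x ∧ Q x x)
  ...   | inj₂ I∩Q=∅ = inj₁ (I≗ground , min-v)
    where open CutOfGraft adm
          open WithP (∧-fst IPp) (∧-snd {I p} IPp)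
          open WithoutQ (λ x Ix Qxx → I∩Q=∅ x (∧-intro Ix Qxx))
  ...   | inj₁ (q , IQq) = inj₂ (J-admissible , I≗extendCut)
    where open CutOfGraft adm
          open WithP (∧-fst IPp) (∧-snd {I p} IPp)
          open WithQ (∧-fst IQq) (∧-snd {I q} IQq)

  restrict-ground-P : restrict G (ground P) ≐ P
  restrict-ground-P x y = T-ext (λ r → graft-fromP (restrict-dom G (ground P) r) (restrict-rel G (ground P) r))
                                (λ Pxy → restrict-intro G (ground P) (graft-P Pxy) (≤-groundˡ pp Pxy) (≤-groundʳ pp Pxy))

  restrict-compl-ground-P : restrict G (compl (ground P)) ≐ Q
  restrict-compl-ground-P x y = T-ext to-Q from-Q
    where
    S : Sub N
    S = compl (ground P)
    to-Q : T (restrict G S x y) → T (Q x y)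
    to-Q r with graft-cases (restrict-rel G S r)
    ... | inP Pxy = ⊥-elim (not-elim (restrict-dom G S r) (≤-groundˡ pp Pxy))
    ... | inQ Qxy = Qxy
    ... | across _ Pyy = ⊥-elim (not-elim (restrict-cod G S r) Pyy)
    from-Q : T (Q x y) → T (restrict G S x y)
    from-Q Qxy = restrict-intro G S (graft-Q Qxy) (not-intro (λ Pxx → P∩Q=∅ x Pxx (≤-groundˡ pq Qxy)))
                                                  (not-intro (λ Pyy → P∩Q=∅ y Pyy (≤-groundʳ pq Qxy)))

  module _ {J : Sub N} (J⊆Q : ∀ x → T (J x) → T (Q x x)) where
    private
      I : Sub N
      I = extendCut P v J
      ¬I : Sub N
      ¬I = compl I

      ¬J-P : ∀ {x} → T (P x x) → ¬ T (J x)
      ¬J-P {x} Pxx Jx = P∩Q=∅ x Pxx (J⊆Q x Jx)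

      I-Q⇒J : ∀ {z} → T (I z) → T (Q z z) → T (J z)
      I-Q⇒J Iz Qzz with extendCut-cases J Iz
      ... | inj₁ Jz = Jz
      ... | inj₂ (_ , Pzz) = ⊥-elim (P∩Q=∅ _ Pzz Qzz)

    restrict-extendCut-∋v : T (J v) → restrict G I ≐ graftRel P v (restrict Q J)
    restrict-extendCut-∋v Jv x y = T-ext to-graft from-graft
      where
      to-graft : T (restrict G I x y) → T (graftRel P v (restrict Q J) x y)
      to-graft r with graft-cases (restrict-rel G I r)
      ... | inP Pxy = ∨-inl Pxy
      ... | inQ Qxy = ∨-inr {P x y} (∨-inl (restrict-intro Q J Qxy (I-Q⇒J (restrict-dom G I r) (≤-groundˡ pq Qxy))
                                                                  (I-Q⇒J (restrict-cod G I r) (≤-groundʳ pq Qxy))))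
      ... | across Qxv Pyy = ∨-inr {P x y} (∨-inr {restrict Q J x y}
                               (∧-intro (restrict-intro Q J Qxv (I-Q⇒J (restrict-dom G I r) (≤-groundˡ pq Qxv)) Jv) Pyy))
      from-graft : T (graftRel P v (restrict Q J) x y) → T (restrict G I x y)
      from-graft t with ∨-cases {P x y} t
      ... | inj₁ Pxy = restrict-intro G I (graft-P Pxy) (extendCut-inr J Jv (≤-groundˡ pp Pxy)) (extendCut-inr J Jv (≤-groundʳ pp Pxy))
      ... | inj₂ t′ with ∨-cases {restrict Q J x y} t′
      ...   | inj₁ r = restrict-intro G I (graft-Q (restrict-rel Q J r)) (extendCut-inl J (restrict-dom Q J r))
                                                                        (extendCut-inl J (restrict-cod Q J r))
      ...   | inj₂ t″ = let r = ∧-fst t″ ; Pyy = ∧-snd {restrict Q J x v} t″ in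
                        restrict-intro G I (graft-across (restrict-rel Q J r) Pyy) (extendCut-inl J (restrict-dom Q J r))
                                                                                   (extendCut-inr J Jv Pyy)

    restrict-compl-extendCut-∋v : T (J v) → restrict G ¬I ≐ restrict Q (compl J)
    restrict-compl-extendCut-∋v Jv x y = T-ext to-Q from-Q
      where
      ¬I-Q : ∀ {z} → T (Q z z) → ¬ T (J z) → T (¬I z)
      ¬I-Q Qzz ¬Jz = not-intro (λ Iz → ¬Jz (I-Q⇒J Iz Qzz))
      to-Q : T (restrict G ¬I x y) → T (restrict Q (compl J) x y)
      to-Q r with graft-cases (restrict-rel G ¬I r)
      ... | inP Pxy = ⊥-elim (not-elim (restrict-dom G ¬I r) (extendCut-inr J Jv (≤-groundˡ pp Pxy)))
      ... | inQ Qxy = restrict-intro Q (compl J) Qxy (not-intro (λ Jx → not-elim (restrict-dom G ¬I r) (extendCut-inl J Jx)))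
                                                     (not-intro (λ Jy → not-elim (restrict-cod G ¬I r) (extendCut-inl J Jy)))
      ... | across _ Pyy = ⊥-elim (not-elim (restrict-cod G ¬I r) (extendCut-inr J Jv Pyy))
      from-Q : T (restrict Q (compl J) x y) → T (restrict G ¬I x y)
      from-Q r = let Qxy = restrict-rel Q (compl J) r in
                 restrict-intro G ¬I (graft-Q Qxy) (¬I-Q (≤-groundˡ pq Qxy) (not-elim (restrict-dom Q (compl J) r)))
                                                   (¬I-Q (≤-groundʳ pq Qxy) (not-elim (restrict-cod Q (compl J) r)))

    restrict-extendCut-∌v : ¬ T (J v) → restrict G I ≐ restrict Q J
    restrict-extendCut-∌v ¬Jv x y = trans (restrict-cong {R = G} (λ _ _ → refl) (extendCut-absent J ¬Jv) x y) (T-ext to-Q from-Q)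
      where
      to-Q : T (restrict G J x y) → T (restrict Q J x y)
      to-Q r = restrict-intro Q J (graft-toQ (J⊆Q y (restrict-cod G J r)) (restrict-rel G J r)) (restrict-dom G J r) (restrict-cod G J r)
      from-Q : T (restrict Q J x y) → T (restrict G J x y)
      from-Q r = restrict-intro G J (graft-Q (restrict-rel Q J r)) (restrict-dom Q J r) (restrict-cod Q J r)

    restrict-compl-extendCut-∌v : ¬ T (J v) → restrict G ¬I ≐ graftRel P v (restrict Q (compl J))
    restrict-compl-extendCut-∌v ¬Jv x y =
      trans (restrict-cong {R = G} (λ _ _ → refl) (λ z → cong not (extendCut-absent J ¬Jv z)) x y) (T-ext to-graft from-graft)
      where
      K : Sub N
      K = compl J
      to-graft : T (restrict G K x y) → T (graftRel P v (restrict Q K) x y)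
      to-graft r with graft-cases (restrict-rel G K r)
      ... | inP Pxy = ∨-inl Pxy
      ... | inQ Qxy = ∨-inr {P x y} (∨-inl (restrict-intro Q K Qxy (restrict-dom G K r) (restrict-cod G K r)))
      ... | across Qxv Pyy = ∨-inr {P x y} (∨-inr {restrict Q K x y}
                               (∧-intro (restrict-intro Q K Qxv (restrict-dom G K r) (not-intro ¬Jv)) Pyy))
      from-graft : T (graftRel P v (restrict Q K) x y) → T (restrict G K x y)
      from-graft t with ∨-cases {P x y} t
      ... | inj₁ Pxy = restrict-intro G K (graft-P Pxy) (not-intro (¬J-P (≤-groundˡ pp Pxy))) (not-intro (¬J-P (≤-groundʳ pp Pxy)))
      ... | inj₂ t′ with ∨-cases {restrict Q K x y} t′
      ...   | inj₁ r = restrict-intro G K (graft-Q (restrict-rel Q K r)) (restrict-dom Q K r) (restrict-cod Q K r)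
      ...   | inj₂ t″ = let r = ∧-fst t″ ; Pyy = ∧-snd {restrict Q K x v} t″ in
                        restrict-intro G K (graft-across (restrict-rel Q K r) Pyy) (restrict-dom Q K r) (not-intro (¬J-P Pyy))

open import Data.Rational using (ℚ; 0ℚ; 1ℚ; _+_; _*_)
open import Data.Rational.Properties using (+-identityˡ; +-identityʳ; +-assoc; +-0-commutativeMonoid; *-comm; *-identityˡ)
open import Algebra.Bundles using (CommutativeMonoid)
open import Algebra.Properties.CommutativeSemigroup
  (CommutativeMonoid.commutativeSemigroup +-0-commutativeMonoid) using (interchange)

infixr 7 [_]·_

[_]·_ : Bool → ℚ → ℚ
[ b ]· a = if b then a else 0ℚ

sumOver : ∀ {X : Set} → List X → (X → ℚ) → ℚ
sumOver [] f = 0ℚ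
sumOver (x ∷ xs) f = f x + sumOver xs f

infix 5 sumOver
syntax sumOver xs (λ x → e) = ∑[ x ∈ xs ] e

[]·-true : ∀ {b} a → T b → [ b ]· a ≡ a
[]·-true {true} a _ = refl

[]·-false : ∀ {b} a → ¬ T b → [ b ]· a ≡ 0ℚ
[]·-false {false} a _ = refl
[]·-false {true} a ¬b = ⊥-elim (¬b tt)

[]·-0 : ∀ b → [ b ]· 0ℚ ≡ 0ℚ
[]·-0 true = refl
[]·-0 false = refl

[]·-+ : ∀ b x y → [ b ]· (x + y) ≡ [ b ]· x + [ b ]· y
[]·-+ true x y = refl
[]·-+ false x y = sym (+-identityˡ 0ℚ)

module _ {X : Set} where
  sum-cong : ∀ (xs : List X) {f g : X → ℚ} → (∀ x → f x ≡ g x) → sumOver xs f ≡ sumOver xs g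
  sum-cong [] f≗g = refl
  sum-cong (x ∷ xs) f≗g = cong₂ _+_ (f≗g x) (sum-cong xs f≗g)

  sum-0 : ∀ (xs : List X) → ∑[ x ∈ xs ] 0ℚ ≡ 0ℚ
  sum-0 [] = refl
  sum-0 (x ∷ xs) = trans (+-identityˡ _) (sum-0 xs)

  sum-+ : ∀ (xs : List X) (f g : X → ℚ) → ∑[ x ∈ xs ] (f x + g x) ≡ sumOver xs f + sumOver xs g
  sum-+ [] f g = sym (+-identityʳ 0ℚ)
  sum-+ (x ∷ xs) f g = trans (cong (f x + g x +_) (sum-+ xs f g)) (interchange (f x) (g x) (sumOver xs f) (sumOver xs g))

  sum-[]· : ∀ (xs : List X) b (f : X → ℚ) → ∑[ x ∈ xs ] [ b ]· f x ≡ [ b ]· sumOver xs f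
  sum-[]· xs true f = refl
  sum-[]· xs false f = sum-0 xs

  sum-++ : ∀ (xs ys : List X) (f : X → ℚ) → sumOver (xs ++ ys) f ≡ sumOver xs f + sumOver ys f
  sum-++ [] ys f = sym (+-identityˡ _)
  sum-++ (x ∷ xs) ys f = trans (cong (f x +_) (sum-++ xs ys f)) (sym (+-assoc (f x) _ _))

  sum-concatMap : ∀ {Y : Set} (ys : List Y) (g : Y → List X) (f : X → ℚ) →
                  sumOver (concatMap g ys) f ≡ ∑[ y ∈ ys ] sumOver (g y) f
  sum-concatMap [] g f = refl
  sum-concatMap (y ∷ ys) g f = trans (sum-++ (g y) (concatMap g ys) f) (cong (sumOver (g y) f +_) (sum-concatMap ys g f))

  sum-map : ∀ {Y : Set} (ys : List Y) (g : Y → X) (f : X → ℚ) → sumOver (map g ys) f ≡ ∑[ y ∈ ys ] f (g y)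
  sum-map [] g f = refl
  sum-map (y ∷ ys) g f = cong (f (g y) +_) (sum-map ys g f)

  sum-singleton-if : ∀ b (x : X) (f : X → ℚ) → sumOver (if b then x ∷ [] else []) f ≡ [ b ]· f x
  sum-singleton-if true x f = +-identityʳ _
  sum-singleton-if false x f = refl

sum-swap : ∀ {X Y : Set} (xs : List X) (ys : List Y) (F : X → Y → ℚ) →
           ∑[ x ∈ xs ] ∑[ y ∈ ys ] F x y ≡ ∑[ y ∈ ys ] ∑[ x ∈ xs ] F x y
sum-swap [] ys F = sym (sum-0 ys)
sum-swap (x ∷ xs) ys F = trans (cong (sumOver ys (F x) +_) (sum-swap xs ys F)) (sym (sum-+ ys (F x) (λ y → sumOver xs (λ x′ → F x′ y))))

infixr 7 _•_

_•_ : ℕ → ℚ → ℚ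
zero • c = 0ℚ
suc k • c = c + k • c

•-0 : ∀ k → k • 0ℚ ≡ 0ℚ
•-0 zero = refl
•-0 (suc k) = trans (+-identityˡ _) (•-0 k)

•-[]· : ∀ k b c → k • ([ b ]· c) ≡ [ b ]· (k • c)
•-[]· k true c = refl
•-[]· k false c = •-0 k

sum-indicator : ∀ {n} (f : Fin n → Bool) c → ∑[ i ∈ allFin n ] [ f i ]· c ≡ countF f • c
sum-indicator f c = go (λ i → i) f
  where
  go : ∀ {n} {X : Set} (h : Fin n → X) (g : X → Bool) → ∑[ x ∈ tabulate h ] [ g x ]· c ≡ countF (λ i → g (h i)) • c
  go {zero} h g = refl
  go {suc n} h g with g (h zero)
  ... | true = cong (c +_) (go (λ i → h (suc i)) g)
  ... | false = trans (+-identityˡ _) (go (λ i → h (suc i)) g)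

eqSub : ∀ {N} → Sub N → Sub N → Bool
eqSub I J = allF (λ x → not (I x xor J x))

eqSub-intro : ∀ {N} (I J : Sub N) → I ≗ J → T (eqSub I J)
eqSub-intro I J I≗J = allF-intro (λ x → ≡⇒xnor (I≗J x))

eqSub-elim : ∀ {N} (I J : Sub N) → T (eqSub I J) → I ≗ J
eqSub-elim I J t x = xnor⇒≡ (allF-elim t x)

-- allSubs lists every subset exactly once.
sum-allSubs-eqSub : ∀ n (I₀ : Sub n) a → ∑[ I ∈ allSubs n ] [ eqSub I I₀ ]· a ≡ a
sum-allSubs-eqSub zero I₀ a = +-identityʳ a
sum-allSubs-eqSub (suc n) I₀ a =
  trans (sum-concatMap (allSubs n) _ (λ I → [ eqSub I I₀ ]· a))
        (trans (sum-cong (allSubs n) (λ s → one-extension (I₀ zero) (eqSub s (λ i → I₀ (suc i)))))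
               (sum-allSubs-eqSub n (λ i → I₀ (suc i)) a))
  where
  one-extension : ∀ b₀ e → [ not (false xor b₀) ∧ e ]· a + ([ not (true xor b₀) ∧ e ]· a + 0ℚ) ≡ [ e ]· a
  one-extension false e = trans (cong ([ e ]· a +_) (+-identityˡ 0ℚ)) (+-identityʳ _)
  one-extension true e = trans (+-identityˡ _) (+-identityʳ _)

module _ where
  open import Data.Nat.Properties using (*-identityʳ)
  open import Data.Integer using (+_)
  open import Data.Nat.Coprimality using (1-coprimeTo) renaming (sym to coprime-sym)
  open import Data.Rational using (mkℚ; normalize) renaming (_*_ to _*ℚ_)
  open import Data.Rational.Properties using (normalize-coprime; *-zeroˡ; *-distribʳ-+; *-inverseʳ)

  private
    fromSuc : ℕ → ℚ
    fromSuc n = mkℚ (+ suc n) 0 (coprime-sym (1-coprimeTo (suc n)))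

    -- 1ℚ + fromSuc n reduces definitionally to normalize (suc (suc (n * 1))) 1.
    •-1 : ∀ n → suc n • 1ℚ ≡ fromSuc n
    •-1 zero = +-identityʳ 1ℚ
    •-1 (suc n) = trans (cong (λ t → 1ℚ + t) (•-1 n))
                        (trans (cong (λ m → normalize m 1) (cong (λ t → suc (suc t)) (*-identityʳ n)))
                               (normalize-coprime (coprime-sym (1-coprimeTo (suc (suc n))))))

    •-≡-* : ∀ k c → k • c ≡ (k • 1ℚ) *ℚ c
    •-≡-* zero c = sym (*-zeroˡ c)
    •-≡-* (suc k) c = trans (cong₂ _+_ (sym (*-identityˡ c)) (•-≡-* k c)) (sym (*-distribʳ-+ c 1ℚ (k • 1ℚ)))

  •-invℕ : ∀ n → suc n • invℕ (suc n) ≡ 1ℚ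
  •-invℕ n = trans (•-≡-* (suc n) _)
                   (trans (cong₂ _*ℚ_ (•-1 n) (normalize-coprime (1-coprimeTo (suc n))))
                          (*-inverseʳ (fromSuc n)))

module Coefficients {N : ℕ} (A B : Rel N) where
  matches : Rel N → Rel N → Bool
  matches X Y = eqRel A X ∧ eqRel B Y

  matches-cong : ∀ {X X′ Y Y′} → X ≐ X′ → Y ≐ Y′ → matches X Y ≡ matches X′ Y′
  matches-cong X≐X′ Y≐Y′ = cong₂ _∧_ (eqRel-congʳ {A = A} X≐X′) (eqRel-congʳ {A = B} Y≐Y′)

  termCoef : ℚ × Rel N × Rel N → ℚ
  termCoef (c , X , Y) = [ matches X Y ]· c

  coef≡sum : ∀ (τ : Tensor N) → coef τ A B ≡ sumOver τ termCoef
  coef≡sum [] = refl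
  coef≡sum ((c , X , Y) ∷ τ) = cong ([ matches X Y ]· c +_) (coef≡sum τ)

  cutTerm : Rel N → ℚ → Sub N → ℚ
  cutTerm R c I = [ circ R I ]· [ matches (restrict R I) (restrict R (compl I)) ]· (c * invℕ (numMin R))

  leftGraftTerm : Rel N → Rel N → ℚ → Rel N → Fin N → ℚ
  leftGraftTerm P X c Y v = [ X v v ]· [ matches (graftAt P v X) Y ]· (c * 1ℚ)

  rightGraftTerm : Rel N → Rel N → ℚ → Rel N → Fin N → ℚ
  rightGraftTerm P X c Y v = [ Y v v ]· [ matches X (graftAt P v Y) ]· (c * 1ℚ)

  sum-scaled-δ : ∀ (R : Rel N) c →
    sumOver (map (λ { (d , X , Y) → (c * d , X , Y) }) (δ R)) termCoef ≡ ∑[ I ∈ allSubs N ] cutTerm R c I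
  sum-scaled-δ R c =
    trans (sum-map (δ R) _ termCoef)
      (trans (sum-concatMap (allSubs N) _ _)
        (sum-cong (allSubs N) (λ I → sum-singleton-if (circ R I) _ _)))

  coef-δlin-graft : ∀ P Q → coef (δlin (graft P Q)) A B ≡
    ∑[ v ∈ allFin N ] [ Q v v ]· (∑[ I ∈ allSubs N ] cutTerm (graftAt P v Q) 1ℚ I)
  coef-δlin-graft P Q =
    trans (coef≡sum (δlin (graft P Q)))
      (trans (sum-concatMap (graft P Q) _ termCoef)
        (trans (sum-concatMap (allFin N) _ _)
          (sum-cong (allFin N) (λ v → trans (sum-singleton-if (Q v v) _ _) (cong ([ Q v v ]·_) (sum-scaled-δ (graftAt P v Q) 1ℚ))))))

  coef-graftL : ∀ P Q → coef (graftL P (δ Q)) A B ≡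
    ∑[ J ∈ allSubs N ] [ circ Q J ]· (∑[ v ∈ allFin N ] leftGraftTerm P (restrict Q J) (invℕ (numMin Q)) (restrict Q (compl J)) v)
  coef-graftL P Q =
    trans (coef≡sum (graftL P (δ Q)))
      (trans (sum-concatMap (δ Q) _ termCoef)
        (trans (sum-concatMap (allSubs N) _ _)
          (sum-cong (allSubs N) (λ J → trans (sum-singleton-if (circ Q J) _ _)
            (cong ([ circ Q J ]·_)
              (trans (sum-map (graft P (restrict Q J)) _ termCoef)
                (trans (sum-concatMap (allFin N) _ _)
                  (sum-cong (allFin N) (λ v → sum-singleton-if (restrict Q J v v) _ _)))))))))

  coef-graftR : ∀ P Q → coef (graftR P (δ Q)) A B ≡
    ∑[ J ∈ allSubs N ] [ circ Q J ]· (∑[ v ∈ allFin N ] rightGraftTerm P (restrict Q J) (invℕ (numMin Q)) (restrict Q (compl J)) v)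
  coef-graftR P Q =
    trans (coef≡sum (graftR P (δ Q)))
      (trans (sum-concatMap (δ Q) _ termCoef)
        (trans (sum-concatMap (allSubs N) _ _)
          (sum-cong (allSubs N) (λ J → trans (sum-singleton-if (circ Q J) _ _)
            (cong ([ circ Q J ]·_)
              (trans (sum-map (graft P (restrict Q (compl J))) _ termCoef)
                (trans (sum-concatMap (allFin N) _ _)
                  (sum-cong (allFin N) (λ v → sum-singleton-if (restrict Q (compl J) v v) _ _)))))))))

  coef-rhs : ∀ P Q → coef ((1ℚ , P , Q) ∷ (graftL P (δ Q) ++ graftR P (δ Q))) A B ≡
             [ matches P Q ]· 1ℚ + (coef (graftL P (δ Q)) A B + coef (graftR P (δ Q)) A B)
  coef-rhs P Q =
    trans (coef≡sum ((1ℚ , P , Q) ∷ (graftL P (δ Q) ++ graftR P (δ Q))))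
      (cong ([ matches P Q ]· 1ℚ +_)
        (trans (sum-++ (graftL P (δ Q)) _ termCoef)
               (sym (cong₂ _+_ (coef≡sum (graftL P (δ Q))) (coef≡sum (graftR P (δ Q)))))))

[]·-split : ∀ {a b c} x → (T c → T a ⊎ T b) → (T a → T c) → (T b → T c) → (T a → T b → ⊥) →
            [ c ]· x ≡ [ a ]· x + [ b ]· x
[]·-split {true}  {true}          x _  _      _      disjoint = ⊥-elim (disjoint tt tt)
[]·-split {true}  {false} {true}  x _  _      _      _ = sym (+-identityʳ x)
[]·-split {false} {true}  {true}  x _  _      _      _ = sym (+-identityˡ x)
[]·-split {false} {false} {false} x _  _      _      _ = sym (+-identityˡ 0ℚ)
[]·-split {true}  {false} {false} x _  from-a _      _ = ⊥-elim (from-a tt)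
[]·-split {false} {true}  {false} x _  _      from-b _ = ⊥-elim (from-b tt)
[]·-split {false} {false} {true}  x to _      _      _ = [ (λ ()) , (λ ()) ]′ (to tt)

[]·-[]· : ∀ a b x → [ a ]· [ b ]· x ≡ [ a ∧ b ]· x
[]·-[]· true b x = refl
[]·-[]· false b x = refl

[]·-cong : ∀ a {x y} → (T a → x ≡ y) → [ a ]· x ≡ [ a ]· y
[]·-cong true x≡y = x≡y tt
[]·-cong false x≡y = refl

module CutSum {N : ℕ} {P Q : Rel N} (pp : IsPoset P) (pq : IsPoset Q) (P-connected : IsConnected P)
              (P∩Q=∅ : Disjoint P Q) (v : Fin N) (Qvv : T (Q v v)) where
  open GraftOrder pp pq P∩Q=∅ v Qvv
  open GraftCuts pp pq P-connected P∩Q=∅ v Qvv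

  extend : Sub N → Sub N
  extend = extendCut P v

  circ⊆Q : ∀ {J} → T (circ Q J) → ∀ x → T (J x) → T (Q x x)
  circ⊆Q t x Jx with circ-sound {R = Q} t
  ... | w , adm = ≤-groundʳ pq (proj₁ (Above-elim {R = Q} (Admissible.⊆above adm x Jx)))

  extend⇒Qpart : ∀ {I J} → T (circ Q J) → I ≗ extend J → J ≗ Qpart I
  extend⇒Qpart {I} {J} circ-J I≗J′ x = T-ext (λ Jx → ∧-intro (subst T (sym (I≗J′ x)) (extendCut-inl J Jx)) (circ⊆Q circ-J x Jx))
                                           (λ t → from (extendCut-cases J (subst T (I≗J′ x) (∧-fst t))) (∧-snd {I x} t))
    where
    from : T (J x) ⊎ (T (J v) × T (P x x)) → T (Q x x) → T (J x)
    from (inj₁ Jx) _ = Jx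
    from (inj₂ (_ , Pxx)) Qxx = ⊥-elim (P∩Q=∅ x Pxx Qxx)

  circ-graft-split : ∀ I x → [ circ G I ]· x ≡
    [ eqSub I (ground P) ∧ isMin Q v ]· x + [ eqSub I (extend (Qpart I)) ∧ circ Q (Qpart I) ]· x
  circ-graft-split I x = []·-split x to from-ground from-extended disjoint
    where
    to : T (circ G I) → T (eqSub I (ground P) ∧ isMin Q v) ⊎ T (eqSub I (extend (Qpart I)) ∧ circ Q (Qpart I))
    to t with admissible-cases (proj₂ (circ-sound {R = G} t))
    ... | inj₁ (I≗P , min-v) = inj₁ (∧-intro (eqSub-intro I (ground P) I≗P) min-v)
    ... | inj₂ (adm , I≗J′) = inj₂ (∧-intro (eqSub-intro I (extend (Qpart I)) I≗J′) (circ-complete {R = Q} adm))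
    from-ground : T (eqSub I (ground P) ∧ isMin Q v) → T (circ G I)
    from-ground t = subst T (circ-cong {R = G} (λ _ _ → refl) (λ x → sym (eqSub-elim I (ground P) (∧-fst t) x)))
                            (circ-complete {R = G} (ground-admissible (∧-snd {eqSub I (ground P)} t)))
    from-extended : T (eqSub I (extend (Qpart I)) ∧ circ Q (Qpart I)) → T (circ G I)
    from-extended t with circ-sound {R = Q} (∧-snd {eqSub I (extend (Qpart I))} t)
    ... | _ , adm = subst T (circ-cong {R = G} (λ _ _ → refl) (λ x → sym (eqSub-elim I (extend (Qpart I)) (∧-fst t) x)))
                            (circ-complete {R = G} (extend-admissible adm))
    disjoint : T (eqSub I (ground P) ∧ isMin Q v) → T (eqSub I (extend (Qpart I)) ∧ circ Q (Qpart I)) → ⊥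
    disjoint t u with circ-sound {R = Q} (∧-snd {eqSub I (extend (Qpart I))} u)
    ... | _ , adm with proj₁ (Admissible.connected adm)
    ... | x , r = P∩Q=∅ x (subst T (eqSub-elim I (ground P) (∧-fst t) x) (∧-fst J′x)) (∧-snd {I x} J′x)
      where
      J′x : T (Qpart I x)
      J′x = restrict-dom Q (Qpart I) r

  module _ (F : Sub N → ℚ) (F-cong : ∀ {I I′} → I ≗ I′ → F I ≡ F I′) where
    sum-ground-term : ∑[ I ∈ allSubs N ] [ eqSub I (ground P) ∧ isMin Q v ]· F I ≡ [ isMin Q v ]· F (ground P)
    sum-ground-term =
      trans (sum-cong (allSubs N) (λ I → trans (sym ([]·-[]· (eqSub I (ground P)) (isMin Q v) (F I)))
                                        ([]·-cong (eqSub I (ground P)) (λ t → cong ([ isMin Q v ]·_) (F-cong (eqSub-elim I (ground P) t))))))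
        (sum-allSubs-eqSub N (ground P) _)

    extend-Qpart-bijection : ∀ I J → [ eqSub I (extend J) ]· [ circ Q J ]· F (extend J) ≡
                                     [ eqSub J (Qpart I) ]· [ eqSub I (extend (Qpart I)) ∧ circ Q (Qpart I) ]· F I
    extend-Qpart-bijection I J with T-cases (eqSub J (Qpart I))
    ... | inj₁ t = trans ([]·-cong (eqSub I (extend J)) (λ e → cong ([ circ Q J ]·_) (F-cong (λ x → sym (eqSub-elim I (extend J) e x)))))
                     (trans ([]·-[]· (eqSub I (extend J)) (circ Q J) (F I))
                       (trans (cong₂ (λ e c → [ e ∧ c ]· F I) (allF-cong (λ x → cong (λ b → not (I x xor b)) (extendCut-cong {P = P} J≗J′ x)))
                                                             (circ-cong {R = Q} (λ _ _ → refl) J≗J′))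
                              (sym ([]·-true _ t))))
      where
      J≗J′ : J ≗ Qpart I
      J≗J′ = eqSub-elim J (Qpart I) t
    ... | inj₂ ¬t = trans ([]·-[]· (eqSub I (extend J)) (circ Q J) _)
                          (trans ([]·-false _ (λ u → ¬t (eqSub-intro J (Qpart I) (extend⇒Qpart (∧-snd {eqSub I (extend J)} u) (eqSub-elim I (extend J) (∧-fst u))))))
                                 (sym ([]·-false _ ¬t)))

    sum-extended-terms : ∑[ I ∈ allSubs N ] [ eqSub I (extend (Qpart I)) ∧ circ Q (Qpart I) ]· F I ≡
                         ∑[ J ∈ allSubs N ] [ circ Q J ]· F (extend J)
    sum-extended-terms = begin
      ∑[ I ∈ allSubs N ] [ eqSub I (extend (Qpart I)) ∧ circ Q (Qpart I) ]· F I
        ≡⟨ sum-cong (allSubs N) (λ I → sym (sum-allSubs-eqSub N (Qpart I) _)) ⟩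
      ∑[ I ∈ allSubs N ] ∑[ J ∈ allSubs N ] [ eqSub J (Qpart I) ]· [ eqSub I (extend (Qpart I)) ∧ circ Q (Qpart I) ]· F I
        ≡⟨ sum-cong (allSubs N) (λ I → sum-cong (allSubs N) (λ J → sym (extend-Qpart-bijection I J))) ⟩
      ∑[ I ∈ allSubs N ] ∑[ J ∈ allSubs N ] [ eqSub I (extend J) ]· [ circ Q J ]· F (extend J)
        ≡⟨ sum-swap (allSubs N) (allSubs N) _ ⟩
      ∑[ J ∈ allSubs N ] ∑[ I ∈ allSubs N ] [ eqSub I (extend J) ]· [ circ Q J ]· F (extend J)
        ≡⟨ sum-cong (allSubs N) (λ J → sum-allSubs-eqSub N (extend J) _) ⟩
      ∑[ J ∈ allSubs N ] [ circ Q J ]· F (extend J) ∎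
      where open ≡-Reasoning

    sum-cuts-of-graft : ∑[ I ∈ allSubs N ] [ circ G I ]· F I ≡
                        [ isMin Q v ]· F (ground P) + (∑[ J ∈ allSubs N ] [ circ Q J ]· F (extend J))
    sum-cuts-of-graft =
      trans (sum-cong (allSubs N) (λ I → circ-graft-split I (F I)))
        (trans (sum-+ (allSubs N) _ _) (cong₂ _+_ sum-ground-term sum-extended-terms))

module CoefficientIdentity {N : ℕ} {P Q : Rel N} (pp : IsPoset P) (pq : IsPoset Q) (P-connected : IsConnected P)
                           (P∩Q=∅ : Disjoint P Q) (A B : Rel N) where
  open Coefficients A B

  c : ℚ
  c = invℕ (numMin Q)

  graftTerms : Fin N → Sub N → ℚ
  graftTerms v J = leftGraftTerm P (restrict Q J) c (restrict Q (compl J)) v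
                 + rightGraftTerm P (restrict Q J) c (restrict Q (compl J)) v

  graftAt-restrict : ∀ v (S : Sub N) → T (restrict Q S v v) → graftAt P v (restrict Q S) ≐ graftRel P v (restrict Q S)
  graftAt-restrict v S QSvv = GraftOrder.graftAt≐graftRel pp (restrict-isPoset S pq) (restrict-disjoint {P = P} {Q = Q} S P∩Q=∅) v QSvv

  module AtVertex (v : Fin N) (Qvv : T (Q v v)) where
    open GraftOrder pp pq P∩Q=∅ v Qvv
    open GraftCuts pp pq P-connected P∩Q=∅ v Qvv
    open CutSum pp pq P-connected P∩Q=∅ v Qvv

    F : Sub N → ℚ
    F I = [ matches (restrict G I) (restrict G (compl I)) ]· (1ℚ * c)

    F-cong : ∀ {I I′} → I ≗ I′ → F I ≡ F I′
    F-cong I≗I′ = cong ([_]· (1ℚ * c)) (matches-cong (restrict-cong {R = G} (λ _ _ → refl) I≗I′)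
                                                     (restrict-cong {R = G} (λ _ _ → refl) (λ x → cong not (I≗I′ x))))

    cutTerm-graftAt : ∀ I → cutTerm (graftAt P v Q) 1ℚ I ≡ [ circ G I ]· F I
    cutTerm-graftAt I =
      cong₂ [_]·_ (circ-cong graftAt≐graftRel (λ _ → refl))
        (cong₂ [_]·_ (matches-cong (restrict-cong graftAt≐graftRel {I = I} (λ _ → refl))
                                   (restrict-cong graftAt≐graftRel {I = compl I} (λ _ → refl)))
                     (cong (λ n → 1ℚ * invℕ n) (trans (numMin-cong graftAt≐graftRel) (countF-cong isMin-graft))))

    F-ground : F (ground P) ≡ [ matches P Q ]· (1ℚ * c)
    F-ground = cong ([_]· (1ℚ * c)) (matches-cong restrict-ground-P restrict-compl-ground-P)

    F-extend : ∀ J → T (circ Q J) → F (extendCut P v J) ≡ graftTerms v J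
    F-extend J circ-J with T-cases (J v)
    ... | inj₁ Jv =
      trans (cong₂ [_]·_ (matches-cong (λ x y → trans (restrict-extendCut-∋v J⊆Q Jv x y) (sym (graftAt-restrict v J QJvv x y)))
                                       (restrict-compl-extendCut-∋v J⊆Q Jv))
                         (*-comm 1ℚ c))
            (sym (trans (cong₂ _+_ ([]·-true _ QJvv) ([]·-false _ (λ r → not-elim (restrict-dom Q (compl J) r) Jv)))
                        (+-identityʳ _)))
      where
      J⊆Q : ∀ x → T (J x) → T (Q x x)
      J⊆Q = circ⊆Q circ-J
      QJvv : T (restrict Q J v v)
      QJvv = restrict-ground Q J Qvv Jv
    ... | inj₂ ¬Jv =
      trans (cong₂ [_]·_ (matches-cong (restrict-extendCut-∌v J⊆Q ¬Jv)
                                       (λ x y → trans (restrict-compl-extendCut-∌v J⊆Q ¬Jv x y) (sym (graftAt-restrict v (compl J) QJ′vv x y))))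
                         (*-comm 1ℚ c))
            (sym (trans (cong₂ _+_ ([]·-false _ (λ r → ¬Jv (restrict-dom Q J r))) ([]·-true _ QJ′vv))
                        (+-identityˡ _)))
      where
      J⊆Q : ∀ x → T (J x) → T (Q x x)
      J⊆Q = circ⊆Q circ-J
      QJ′vv : T (restrict Q (compl J) v v)
      QJ′vv = restrict-ground Q (compl J) Qvv (not-intro ¬Jv)

  vertexTerm : Fin N → ℚ
  vertexTerm v = [ Q v v ]· (∑[ I ∈ allSubs N ] cutTerm (graftAt P v Q) 1ℚ I)

  vertexTerm-split : ∀ v → vertexTerm v ≡ [ isMin Q v ]· [ matches P Q ]· (1ℚ * c) + (∑[ J ∈ allSubs N ] [ circ Q J ]· graftTerms v J)
  vertexTerm-split v with T-cases (Q v v)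
  ... | inj₁ Qvv = begin
    [ Q v v ]· (∑[ I ∈ allSubs N ] cutTerm (graftAt P v Q) 1ℚ I)
      ≡⟨ []·-true _ Qvv ⟩
    ∑[ I ∈ allSubs N ] cutTerm (graftAt P v Q) 1ℚ I
      ≡⟨ sum-cong (allSubs N) cutTerm-graftAt ⟩
    ∑[ I ∈ allSubs N ] [ circ G I ]· F I
      ≡⟨ sum-cuts-of-graft F F-cong ⟩
    [ isMin Q v ]· F (ground P) + (∑[ J ∈ allSubs N ] [ circ Q J ]· F (extendCut P v J))
      ≡⟨ cong₂ _+_ (cong ([ isMin Q v ]·_) F-ground)
                   (sum-cong (allSubs N) (λ J → []·-cong (circ Q J) (F-extend J))) ⟩
    [ isMin Q v ]· [ matches P Q ]· (1ℚ * c) + (∑[ J ∈ allSubs N ] [ circ Q J ]· graftTerms v J) ∎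
    where
    open ≡-Reasoning
    open AtVertex v Qvv
    open GraftOrder pp pq P∩Q=∅ v Qvv using (G)
    open CutSum pp pq P-connected P∩Q=∅ v Qvv using (sum-cuts-of-graft)
  ... | inj₂ ¬Qvv =
    trans ([]·-false _ ¬Qvv)
          (sym (trans (cong₂ _+_ ([]·-false _ (λ min-v → ¬Qvv (isMin-ground {R = Q} min-v)))
                                 (trans (sum-cong (allSubs N) (λ J → trans (cong ([ circ Q J ]·_) (no-graft-terms J)) ([]·-0 (circ Q J))))
                                        (sum-0 (allSubs N))))
                      (+-identityˡ 0ℚ)))
    where
    no-graft-terms : ∀ J → graftTerms v J ≡ 0ℚ
    no-graft-terms J = trans (cong₂ _+_ ([]·-false _ (λ r → ¬Qvv (restrict-rel Q J r)))
                                        ([]·-false _ (λ r → ¬Qvv (restrict-rel Q (compl J) r))))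
                             (+-identityˡ 0ℚ)

  sum-minimal-vertices : IsConnected Q →
                         ∑[ v ∈ allFin N ] [ isMin Q v ]· [ matches P Q ]· (1ℚ * c) ≡ [ matches P Q ]· 1ℚ
  sum-minimal-vertices ((q , Qqq) , _) with minimal-below pq q Qqq
  ... | m , min-m , _ with countF-pos (isMin Q) m min-m
  ... | k , numMin≡1+k = begin
    ∑[ v ∈ allFin N ] [ isMin Q v ]· [ matches P Q ]· (1ℚ * c) ≡⟨ sum-indicator (isMin Q) _ ⟩
    numMin Q • [ matches P Q ]· (1ℚ * c)                       ≡⟨ •-[]· (numMin Q) (matches P Q) _ ⟩
    [ matches P Q ]· (numMin Q • (1ℚ * c))                     ≡⟨ cong (λ x → [ matches P Q ]· (numMin Q • x)) (*-identityˡ c) ⟩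
    [ matches P Q ]· (numMin Q • invℕ (numMin Q))              ≡⟨ cong (λ n → [ matches P Q ]· (n • invℕ n)) numMin≡1+k ⟩
    [ matches P Q ]· (suc k • invℕ (suc k))                    ≡⟨ cong ([ matches P Q ]·_) (•-invℕ k) ⟩
    [ matches P Q ]· 1ℚ                                        ∎
    where open ≡-Reasoning

  sum-graft-terms : ∑[ v ∈ allFin N ] ∑[ J ∈ allSubs N ] [ circ Q J ]· graftTerms v J ≡
                    coef (graftL P (δ Q)) A B + coef (graftR P (δ Q)) A B
  sum-graft-terms = begin
    ∑[ v ∈ allFin N ] ∑[ J ∈ allSubs N ] [ circ Q J ]· graftTerms v J
      ≡⟨ sum-swap (allFin N) (allSubs N) _ ⟩
    ∑[ J ∈ allSubs N ] ∑[ v ∈ allFin N ] [ circ Q J ]· graftTerms v J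
      ≡⟨ sum-cong (allSubs N) (λ J → trans (sum-[]· (allFin N) (circ Q J) (λ v → graftTerms v J))
                                           (trans (cong ([ circ Q J ]·_) (sum-+ (allFin N) _ _)) ([]·-+ (circ Q J) _ _))) ⟩
    ∑[ J ∈ allSubs N ] ([ circ Q J ]· (∑[ v ∈ allFin N ] leftGraftTerm P (restrict Q J) c (restrict Q (compl J)) v)
                       + [ circ Q J ]· (∑[ v ∈ allFin N ] rightGraftTerm P (restrict Q J) c (restrict Q (compl J)) v))
      ≡⟨ sum-+ (allSubs N) _ _ ⟩
    _ ≡⟨ sym (cong₂ _+_ (coef-graftL P Q) (coef-graftR P Q)) ⟩
    coef (graftL P (δ Q)) A B + coef (graftR P (δ Q)) A B ∎
    where open ≡-Reasoning

  coef-identity : IsConnected Q →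
    coef (δlin (graft P Q)) A B ≡ coef ((1ℚ , P , Q) ∷ (graftL P (δ Q) ++ graftR P (δ Q))) A B
  coef-identity Q-connected = begin
    coef (δlin (graft P Q)) A B
      ≡⟨ coef-δlin-graft P Q ⟩
    ∑[ v ∈ allFin N ] vertexTerm v
      ≡⟨ sum-cong (allFin N) vertexTerm-split ⟩
    ∑[ v ∈ allFin N ] ([ isMin Q v ]· [ matches P Q ]· (1ℚ * c) + (∑[ J ∈ allSubs N ] [ circ Q J ]· graftTerms v J))
      ≡⟨ sum-+ (allFin N) _ _ ⟩
    _ ≡⟨ cong₂ _+_ (sum-minimal-vertices Q-connected) sum-graft-terms ⟩
    [ matches P Q ]· 1ℚ + (coef (graftL P (δ Q)) A B + coef (graftR P (δ Q)) A B)
      ≡⟨ sym (coef-rhs P Q) ⟩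
    coef ((1ℚ , P , Q) ∷ (graftL P (δ Q) ++ graftR P (δ Q))) A B ∎
    where open ≡-Reasoning

theorem3p11 : ∀ {N : ℕ} (P Q : Rel N) →
    IsPoset P → IsPoset Q → IsConnected P → IsConnected Q → Disjoint P Q →
    δlin (graft P Q) ≈ᵀ ((1ℚ , P , Q) ∷ (graftL P (δ Q) ++ graftR P (δ Q)))
theorem3p11 P Q pp pq P-connected Q-connected P∩Q=∅ A B =
  CoefficientIdentity.coef-identity pp pq P-connected P∩Q=∅ A B Q-connected
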